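{- Let $T$ be a tree and $G$ a finite simple graph with $X_T^T=X_G^G$. Then $G$ is a tree, unless $T\cong P_3$ (the path on 3 vertices) and $G\cong K_1\sqcup K_2$ (an isolated vertex together with a disjoint edge).
   Context: All graphs are finite and simple. A graph homomorphism $f:G\to H$ is a map $f:V(G)\to V(H)$ such that $uv\in E(G)$ implies $f(u)f(v)\in E(H)$. The type of $f$ is the integer partition whose parts are the nonzero sizes $|f^{ -1}(w)|$, $w\in V(H)$. For a partition $\lambda$ with $r_i(\lambda)$ parts equal to $i$ and length $\ell(\lambda)\le N$, set $m_\lambda^N=\frac{N!}{\binom{N}{r_1(\lambda),r_2(\lambda),\dots,N-\ell(\lambda)}}m_\lambda$, where $m_\lambda$ is the monomial symmetric function. The $H$-chromatic symmetric function is $X_G^H=\sum_\lambda d_\lambda m_\lambda^{|V(H)|}$, where $d_\lambda$ is the number of homomorphisms $G\to H$ of type $\lambda$. The self-chromatic symmetric function of $G$ is $X_G^G$. -}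

module Defs where

open import Data.Nat using (ℕ; zero; suc; _+_; _*_; _∸_; _<_; _≤_; _≟_; _≤?_)
open import Data.Empty using (⊥)
open import Data.Nat.Properties using (≤-decTotalOrder; ≤-totalOrder)
open import Data.Nat using (_!)
open import Data.Nat.ListAction using (product)
open import Data.Bool using (Bool; true; false; _∧_; _∨_; not)
open import Data.Fin using (Fin; zero; suc; inject₁; fromℕ)
import Data.Fin as F
open import Data.List using (List; []; _∷_; length; filter; map; allFin; concatMap; upTo; foldr)
open import Data.List.Relation.Unary.All using (All)
import Data.List.Properties as LP
import Data.Bool.Properties as B
open import Relation.Binary.PropositionalEquality using (refl)
open import Data.Product using (Σ; _×_; _,_)
open import Function using (_∘_)
open import Function.Definitions using (Injective)
open import Function.Bundles using (_⤖_; Bijection)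
open import Relation.Binary.PropositionalEquality using (_≡_)
open import Relation.Binary.Construct.Closure.ReflexiveTransitive using (Star)
open import Relation.Nullary.Decidable using (does)

record Graph : Set where
  field
    n       : ℕ
    adj     : Fin n → Fin n → Bool
    symm    : ∀ u v → adj u v ≡ adj v u
    irrefl  : ∀ u → adj u u ≡ false
open Graph public

Adj : (G : Graph) → Fin (n G) → Fin (n G) → Set
Adj G u v = adj G u v ≡ true

_≅_ : Graph → Graph → Set
G ≅ H = Σ (Fin (n G) ⤖ Fin (n H)) λ φ →
          ∀ u v → adj H (Bijection.to φ u) (Bijection.to φ v) ≡ adj G u v

Connected : Graph → Set
Connected G = (0 < n G) × (∀ u v → Star (Adj G) u v)

HasCycle : Graph → Set
HasCycle G = Σ ℕ λ k → Σ (Fin (suc (suc (suc k))) → Fin (n G)) λ c →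
  Injective _≡_ _≡_ c ×
  (∀ (i : Fin (suc (suc k))) → Adj G (c (inject₁ i)) (c (suc i))) ×
  Adj G (c (fromℕ (suc (suc k)))) (c zero)

IsTree : Graph → Set
IsTree G = Connected G × (HasCycle G → ⊥)

allMaps : (a b : ℕ) → List (Fin a → Fin b)
allMaps zero    b = (λ ()) ∷ []
allMaps (suc a) b =
  concatMap (λ w → map (λ f → λ { zero → w ; (suc i) → f i }) (allMaps a b)) (allFin b)

allB : ∀ {A : Set} → (A → Bool) → List A → Bool
allB p = foldr (λ x b → p x ∧ b) true

isHom : (G H : Graph) → (Fin (n G) → Fin (n H)) → Bool
isHom G H f = allB (λ u → allB (λ v → not (adj G u v) ∨ adj H (f u) (f v)) (allFin (n G))) (allFin (n G))

homs : (G H : Graph) → List (Fin (n G) → Fin (n H))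
homs G H = filter (λ f → isHom G H f B.≟ true) (allMaps (n G) (n H))

-- Integer partitions, represented as nondecreasing lists of positive
-- naturals (the order of parts is a fixed convention).

open import Data.List.Sort.InsertionSort.Base ≤-decTotalOrder using (sort)
open import Data.List.Relation.Unary.Sorted.TotalOrder ≤-totalOrder using (Sorted)

IsPartition : List ℕ → Set
IsPartition λ′ = Sorted λ′ × All (0 <_) λ′

fibre : ∀ {a b} → (Fin a → Fin b) → Fin b → ℕ
fibre {a} f w = length (filter (λ u → f u F.≟ w) (allFin a))

typeOf : ∀ {a b} → (Fin a → Fin b) → List ℕ
typeOf {a} {b} f = sort (filter (λ k → 1 ≤? k) (map (fibre f) (allFin b)))

d : (G H : Graph) → List ℕ → ℕ
d G H λ′ = length (filter (λ f → LP.≡-dec _≟_ (typeOf f) λ′) (homs G H))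

r : ℕ → List ℕ → ℕ
r i λ′ = length (filter (i ≟_) λ′)

-- N! / multinomial(N; r₁(λ), r₂(λ), …, N − ℓ(λ))
--   = r₁(λ)! · r₂(λ)! ⋯ r_N(λ)! · (N − ℓ(λ))!   (parts of λ are ≤ N when ℓ(λ) ≤ N)
mScale : ℕ → List ℕ → ℕ
mScale N λ′ = product (map (λ i → (r (suc i) λ′) !) (upTo N)) * ((N ∸ length λ′) !)

-- X_G^H, represented by its coefficient on the monomial symmetric function m_λ
-- (the m_λ form a basis, so X is determined by these coefficients):
-- X_G^H = Σ_λ d_λ · mScale |V(H)| λ · m_λ.
XCoeff : (G H : Graph) → List ℕ → ℕ
XCoeff G H λ′ = d G H λ′ * mScale (n H) λ′

SameSelfX : (T G : Graph) → Set
SameSelfX T G = ∀ (λ′ : List ℕ) → IsPartition λ′ → XCoeff T T λ′ ≡ XCoeff G G λ′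

p3adj : Fin 3 → Fin 3 → Bool
p3adj zero (suc zero) = true
p3adj (suc zero) zero = true
p3adj (suc zero) (suc (suc zero)) = true
p3adj (suc (suc zero)) (suc zero) = true
p3adj _ _ = false

P₃ : Graph
P₃ = record { n = 3 ; adj = p3adj ; symm = s ; irrefl = ir }
  where
    s : ∀ u v → p3adj u v ≡ p3adj v u
    s zero zero = refl
    s zero (suc zero) = refl
    s zero (suc (suc zero)) = refl
    s (suc zero) zero = refl
    s (suc zero) (suc zero) = refl
    s (suc zero) (suc (suc zero)) = refl
    s (suc (suc zero)) zero = refl
    s (suc (suc zero)) (suc zero) = refl
    s (suc (suc zero)) (suc (suc zero)) = refl
    ir : ∀ u → p3adj u u ≡ false
    ir zero = refl
    ir (suc zero) = refl
    ir (suc (suc zero)) = refl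

k12adj : Fin 3 → Fin 3 → Bool
k12adj (suc zero) (suc (suc zero)) = true
k12adj (suc (suc zero)) (suc zero) = true
k12adj _ _ = false

K₁⊔K₂ : Graph
K₁⊔K₂ = record { n = 3 ; adj = k12adj ; symm = s ; irrefl = ir }
  where
    s : ∀ u v → k12adj u v ≡ k12adj v u
    s zero zero = refl
    s zero (suc zero) = refl
    s zero (suc (suc zero)) = refl
    s (suc zero) zero = refl
    s (suc zero) (suc zero) = refl
    s (suc zero) (suc (suc zero)) = refl
    s (suc (suc zero)) zero = refl
    s (suc (suc zero)) (suc zero) = refl
    s (suc (suc zero)) (suc (suc zero)) = refl
    ir : ∀ u → k12adj u u ≡ false
    ir zero = refl
    ir (suc zero) = refl
    ir (suc (suc zero)) = refl

{-# OPTIONS --safe #-}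
module Submission where

-- The coefficient of the type 1ⁿ (the identity) shows that G also has n vertices, and the
-- coefficients of the two-part types add up to the number of endomorphisms whose image is a single
-- edge. A tree with n − 1 edges has only two proper 2-colourings, hence between 1 and 2(n − 1) such
-- endomorphisms. The type (n) shows that G has an edge, so G has such an endomorphism and is
-- bipartite. If G has c components and e edges, then e ≥ n − c, and recolouring components
-- independently gives at least 2e·β(c − 1) of these endomorphisms, where β(0) = 1, β(1) = 2 and
-- β(r + 2) = r + 4. Hence either c = 1 and e = n − 1, so G is a tree, or c = 2, e = 1 and n = 3,
-- which is P₃ against K₁ ⊔ K₂.

open import Defs
open import Level using (0ℓ)
open import Function using (_∘_; id; case_of_)
open import Data.Empty using (⊥; ⊥-elim)
open import Data.Unit using (⊤; tt)
open import Data.Bool using (Bool; true; false; not; _∧_; _∨_; if_then_else_)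
import Data.Bool.Properties as Bool
open import Data.Nat using (ℕ; zero; suc; _+_; _*_; _<_; _≤_; z≤n; s≤s; s≤s⁻¹; _≤?_; _<?_)
import Data.Nat as ℕ
open import Data.Nat.Properties
  using ( ≤-reflexive; ≤-trans; ≤-antisym; <-irrefl; <-asym; <-cmp; n≮n; ≤∧≢⇒<; m≤n⇒m≤1+n; n<1⇒n≡0
        ; +-suc; +-identityʳ; +-monoʳ-≤; *-comm; *-assoc; *-identityʳ; *-cancelʳ-≡; *-cancelʳ-≤
        ; m≤m*n; m*n≢0; _!≢0; ≤-decTotalOrder; ≤-totalOrder; module ≤-Reasoning )
open import Data.Nat.ListAction using (sum)
open import Data.Nat.ListAction.Properties using (product≢0)
open import Data.Fin using (Fin; zero; suc; toℕ; inject₁; fromℕ; fromℕ<)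
import Data.Fin as Fin
import Data.Fin.Properties as Fin
open import Data.Product using (Σ; ∃-syntax; _×_; _,_; proj₁; proj₂; swap)
open import Data.Product.Properties using (≡-dec)
open import Data.Product.Relation.Binary.Pointwise.NonDependent using (_×ₛ_)
open import Data.Sum using (_⊎_; inj₁; inj₂; [_,_]′)
open import Data.List
  using ( List; []; _∷_; _++_; length; filter; map; foldl; allFin; upTo; lookup
        ; cartesianProduct; cartesianProductWith; concatMap )
import Data.List.Properties as List
open import Data.List.Relation.Unary.All using (All; []; _∷_)
import Data.List.Relation.Unary.All as All
open import Data.List.Relation.Unary.Any using (Any; here; there)
import Data.List.Relation.Unary.Any as Any
open import Data.List.Relation.Unary.AllPairs using (AllPairs; []; _∷_)
import Data.List.Relation.Unary.AllPairs as AllPairs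
import Data.List.Relation.Unary.AllPairs.Properties as AllPairs
open import Data.List.Relation.Unary.Unique.Propositional using (Unique)
import Data.List.Relation.Unary.Unique.Propositional.Properties as Unique
import Data.List.Relation.Unary.Unique.Setoid as Uniqueₛ
import Data.List.Relation.Unary.Unique.Setoid.Properties as UniqueₛProperties
open import Data.List.Membership.Propositional using (_∈_; _∉_; find)
import Data.List.Membership.Propositional.Properties as ∈
import Data.List.Membership.Setoid as Membershipₛ
import Data.List.Membership.Setoid.Properties as MembershipₛProperties
open import Relation.Nullary using (¬_; Dec; yes; no; does; ¬?; _×-dec_; _⊎-dec_)
open import Relation.Nullary.Decidable using (dec-true; dec-false; does-⇔; True; toWitness)
open import Relation.Unary using (Pred; Decidable; _≐_)
open import Relation.Binary using (Setoid; DecSetoid; DecidableEquality; tri<; tri≈; tri>)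
open import Relation.Binary.PropositionalEquality
  using (_≡_; _≢_; refl; sym; trans; cong; cong₂; subst; subst₂; _≗_; module ≡-Reasoning)
import Relation.Binary.PropositionalEquality.Properties as ≡
open import Relation.Binary.Construct.Closure.ReflexiveTransitive using (Star; ε; _◅_; _◅◅_; reverse)
open import Function.Bundles using (_⇔_; mk⇔; Equivalence; _⤖_; Bijection)
open import Function.Properties.Inverse using (↔⇒⤖)
import Data.Fin.Permutation as Permutation
open Permutation using (_⟨$⟩ʳ_)
open import Data.List.Sort.InsertionSort.Base ≤-decTotalOrder using (sort)
import Data.List.Sort.InsertionSort.Properties ≤-decTotalOrder as Sort
import Data.List.Relation.Binary.Permutation.Propositional as Perm
import Data.List.Relation.Binary.Permutation.Propositional.Properties as Perm
import Data.List.Relation.Unary.All.Properties as AllP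
open import Data.List.Relation.Unary.Sorted.TotalOrder ≤-totalOrder using (sorted?)

countᵇ : {A : Set} → (A → Bool) → List A → ℕ
countᵇ p []       = 0
countᵇ p (x ∷ xs) = if p x then suc (countᵇ p xs) else countᵇ p xs

module _ {A : Set} where

  length-filter≡countᵇ : ∀ {P : Pred A 0ℓ} (P? : Decidable P) xs →
                         length (filter P? xs) ≡ countᵇ (does ∘ P?) xs
  length-filter≡countᵇ P? []       = refl
  length-filter≡countᵇ P? (x ∷ xs) with does (P? x)
  ... | true  = cong suc (length-filter≡countᵇ P? xs)
  ... | false = length-filter≡countᵇ P? xs

  countᵇ-cong : ∀ (p q : A → Bool) xs → (∀ x → p x ≡ q x) → countᵇ p xs ≡ countᵇ q xs
  countᵇ-cong p q []       p≗q = refl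
  countᵇ-cong p q (x ∷ xs) p≗q with p x | q x | p≗q x
  ... | true  | true  | _ = cong suc (countᵇ-cong p q xs p≗q)
  ... | false | false | _ = countᵇ-cong p q xs p≗q

  countᵇ-split : ∀ (p r : A → Bool) xs →
                 countᵇ p xs ≡ countᵇ (λ x → p x ∧ r x) xs + countᵇ (λ x → p x ∧ not (r x)) xs
  countᵇ-split p r []       = refl
  countᵇ-split p r (x ∷ xs) with p x | r x
  ... | true  | true  = cong suc (countᵇ-split p r xs)
  ... | true  | false = trans (cong suc (countᵇ-split p r xs)) (sym (+-suc _ _))
  ... | false | _     = countᵇ-split p r xs

  countᵇ-none : ∀ (p : A → Bool) xs → (∀ x → p x ≡ false) → countᵇ p xs ≡ 0
  countᵇ-none p []       none = refl
  countᵇ-none p (x ∷ xs) none rewrite none x = countᵇ-none p xs none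

  length-filter-map : ∀ {B : Set} {P : Pred B 0ℓ} (P? : Decidable P) (g : A → B) xs →
                      length (filter P? (map g xs)) ≡ length (filter (P? ∘ g) xs)
  length-filter-map P? g []       = refl
  length-filter-map P? g (x ∷ xs) with does (P? (g x))
  ... | true  = cong suc (length-filter-map P? g xs)
  ... | false = length-filter-map P? g xs

  nonempty-filter : ∀ {P : Pred A 0ℓ} (P? : Decidable P) xs →
                    1 ≤ length (filter P? xs) → ∃[ x ] x ∈ xs × P x
  nonempty-filter P? xs h with filter P? xs in eq
  ... | x ∷ _ = x , ∈.∈-filter⁻ P? (subst (x ∈_) (sym eq) (here refl))

module _ {K A : Set} (_≟_ : DecidableEquality K) (key : A → K) where
  open import Data.List.Membership.DecPropositional _≟_ using (_∈?_)

  private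
    is : K → A → Bool
    is q x = does (key x ≟ q)

    in? : List K → A → Bool
    in? qs x = does (key x ∈? qs)

  sum-countᵇ : ∀ qs → Unique qs → ∀ xs →
    sum (map (λ q → countᵇ (λ x → does (key x ≟ q)) xs) qs) ≡ countᵇ (λ x → does (key x ∈? qs)) xs
  sum-countᵇ []       _          xs = sym (countᵇ-none _ xs (λ _ → refl))
  sum-countᵇ (q ∷ qs) (q∉ ∷ qs!) xs = begin
    countᵇ (is q) xs + sum (map (λ q → countᵇ (is q) xs) qs)
      ≡⟨ cong (countᵇ (is q) xs +_) (sum-countᵇ qs qs! xs) ⟩
    countᵇ (is q) xs + countᵇ (in? qs) xs
      ≡⟨ sym (cong₂ _+_ (countᵇ-cong _ _ xs at-q) (countᵇ-cong _ _ xs off-q)) ⟩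
    countᵇ (λ x → in? (q ∷ qs) x ∧ is q x) xs + countᵇ (λ x → in? (q ∷ qs) x ∧ not (is q x)) xs
      ≡⟨ sym (countᵇ-split (in? (q ∷ qs)) (is q) xs) ⟩
    countᵇ (in? (q ∷ qs)) xs ∎
    where
      open ≡-Reasoning
      at-q : ∀ x → (in? (q ∷ qs) x ∧ is q x) ≡ is q x
      at-q x with key x ≟ q
      ... | yes _ = refl
      ... | no  _ = Bool.∧-zeroʳ _
      off-q : ∀ x → (in? (q ∷ qs) x ∧ not (is q x)) ≡ in? qs x
      off-q x with key x ≟ q
      ... | yes refl = sym (dec-false (key x ∈? qs) (λ q∈ → All.lookup q∉ q∈ refl))
      ... | no  _    = Bool.∧-identityʳ _

length-cartesianProduct : ∀ {A B : Set} (xs : List A) (ys : List B) →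
  length (cartesianProduct xs ys) ≡ length xs * length ys
length-cartesianProduct []       ys = refl
length-cartesianProduct (x ∷ xs) ys = begin
  length (map (x ,_) ys ++ cartesianProduct xs ys)
    ≡⟨ List.length-++ (map (x ,_) ys) ⟩
  length (map (x ,_) ys) + length (cartesianProduct xs ys)
    ≡⟨ cong₂ _+_ (List.length-map (x ,_) ys) (length-cartesianProduct xs ys) ⟩
  length ys + length xs * length ys ∎
  where open ≡-Reasoning

module _ (S : DecSetoid 0ℓ 0ℓ) where
  open DecSetoid S using (Carrier; _≈_) renaming (_≟_ to _≈?_; sym to ≈-sym; trans to ≈-trans)
  open Membershipₛ (DecSetoid.setoid S) using () renaming (_∈_ to _∈ₛ_)
  open Uniqueₛ (DecSetoid.setoid S) using () renaming (Unique to Uniqueₛ)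

  private
    others : Carrier → List Carrier → List Carrier
    others x = filter (λ y → ¬? (y ≈? x))

    length-others : ∀ x ys → Uniqueₛ ys → length ys ≤ suc (length (others x ys))
    length-others x []       _          = z≤n
    length-others x (y ∷ ys) (y∉ ∷ ys!) with y ≈? x
    ... | no _    = s≤s (length-others x ys ys!)
    ... | yes y≈x = s≤s (≤-reflexive (sym (cong length (List.filter-all (λ y → ¬? (y ≈? x))
                          (All.map (λ y≉z z≈x → y≉z (≈-trans y≈x (≈-sym z≈x))) y∉)))))

  unique-⊆⇒length-≤ₛ : ∀ xs ys → Uniqueₛ ys → (∀ {y} → y ∈ₛ ys → y ∈ₛ xs) → length ys ≤ length xs
  unique-⊆⇒length-≤ₛ []       []      _   _   = z≤n
  unique-⊆⇒length-≤ₛ []       (y ∷ _) _   ys⊆ with ys⊆ (here (DecSetoid.refl S))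
  ... | ()
  unique-⊆⇒length-≤ₛ (x ∷ xs) ys      ys! ys⊆ = ≤-trans (length-others x ys ys!)
    (s≤s (unique-⊆⇒length-≤ₛ xs (others x ys)
            (UniqueₛProperties.filter⁺ (DecSetoid.setoid S) _ ys!) others⊆))
    where
      others⊆ : ∀ {y} → y ∈ₛ others x ys → y ∈ₛ xs
      others⊆ y∈ with MembershipₛProperties.∈-filter⁻ (DecSetoid.setoid S) (λ y → ¬? (y ≈? x))
                        (λ y≈z y≉x z≈x → y≉x (≈-trans y≈z z≈x)) y∈
      ... | y∈ys , y≉x with ys⊆ y∈ys
      ...   | here y≈x  = ⊥-elim (y≉x y≈x)
      ...   | there y∈ = y∈

module _ (S : Setoid 0ℓ 0ℓ) (R : DecSetoid 0ℓ 0ℓ) where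
  open Setoid S using () renaming (Carrier to A; _≈_ to _≈₁_)
  open DecSetoid R using () renaming (Carrier to B; _≈_ to _≈₂_)
  open Membershipₛ S using () renaming (_∈_ to _∈₁_)
  open Membershipₛ (DecSetoid.setoid R) using () renaming (_∈_ to _∈₂_)

  injection⇒length-≤ : ∀ (f : A → B) {xs ys} → Uniqueₛ.Unique S xs →
    (∀ {x y} → x ∈₁ xs → y ∈₁ xs → f x ≈₂ f y → x ≈₁ y) →
    (∀ {x} → x ∈₁ xs → f x ∈₂ ys) → length xs ≤ length ys
  injection⇒length-≤ f {xs} {ys} xs! inj into = subst (_≤ length ys) (List.length-map f xs)
    (unique-⊆⇒length-≤ₛ R ys (map f xs) (AllPairs.map⁺ (distinct xs xs! id)) image⊆)
    where
      distinct : ∀ zs → Uniqueₛ.Unique S zs → (∀ {z} → z ∈₁ zs → z ∈₁ xs) →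
                 AllPairs (λ x y → ¬ f x ≈₂ f y) zs
      distinct []       []          _   = []
      distinct (z ∷ zs) (z∉ ∷ zs!) zs⊆ = separated z∉ (zs⊆ ∘ there) ∷ distinct zs zs! (zs⊆ ∘ there)
        where
          separated : ∀ {ws} → All (λ w → ¬ z ≈₁ w) ws → (∀ {w} → w ∈₁ ws → w ∈₁ xs) →
                      All (λ w → ¬ f z ≈₂ f w) ws
          separated []           _   = []
          separated (z≉w ∷ z≉ws) ws⊆ =
            (λ fz≈fw → z≉w (inj (zs⊆ (here (Setoid.refl S))) (ws⊆ (here (Setoid.refl S))) fz≈fw))
            ∷ separated z≉ws (ws⊆ ∘ there)
      image⊆ : ∀ {v} → v ∈₂ map f xs → v ∈₂ ys
      image⊆ v∈ with MembershipₛProperties.∈-map⁻ S (DecSetoid.setoid R) v∈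
      ... | x , x∈ , v≈fx =
        MembershipₛProperties.∈-resp-≈ (DecSetoid.setoid R) (DecSetoid.sym R v≈fx) (into x∈)

module _ {A : Set} (_≟_ : DecidableEquality A) where

  unique-⊆⇒length-≤ : ∀ xs ys → Unique ys → (∀ {y} → y ∈ ys → y ∈ xs) → length ys ≤ length xs
  unique-⊆⇒length-≤ = unique-⊆⇒length-≤ₛ (≡.decSetoid _≟_)

  same-members⇒length-≡ : ∀ {xs ys} → Unique xs → Unique ys →
    (∀ {x} → x ∈ xs → x ∈ ys) → (∀ {y} → y ∈ ys → y ∈ xs) → length xs ≡ length ys
  same-members⇒length-≡ {xs} {ys} xs! ys! xs⊆ys ys⊆xs =
    ≤-antisym (unique-⊆⇒length-≤ ys xs xs! xs⊆ys) (unique-⊆⇒length-≤ xs ys ys! ys⊆xs)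

  length-remove : ∀ {x} xs → Unique xs → x ∈ xs → suc (length (filter (λ y → ¬? (y ≟ x)) xs)) ≡ length xs
  length-remove (y ∷ ys) (y∉ ∷ ys!) (here refl) with y ≟ y
  ... | no y≢y = ⊥-elim (y≢y refl)
  ... | yes _  = cong (suc ∘ length)
                   (List.filter-all (λ z → ¬? (z ≟ y)) (All.map (λ y≢z z≡y → y≢z (sym z≡y)) y∉))
  length-remove {x} (y ∷ ys) (y∉ ∷ ys!) (there x∈) with y ≟ x
  ... | yes refl = ⊥-elim (All.lookup y∉ x∈ refl)
  ... | no _     = cong suc (length-remove ys ys! x∈)

≗-decSetoid : (a : ℕ) (B : Set) → DecidableEquality B → DecSetoid 0ℓ 0ℓ
≗-decSetoid a B _≟_ = record
  { Carrier          = Fin a → B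
  ; _≈_              = _≗_
  ; isDecEquivalence = record
    { isEquivalence = record
      { refl  = λ _ → refl
      ; sym   = λ f≗g x → sym (f≗g x)
      ; trans = λ f≗g g≗h x → trans (f≗g x) (g≗h x)
      }
    ; _≟_ = λ f g → Fin.all? (λ x → f x ≟ g x)
    }
  }

maps : ℕ → ℕ → Setoid 0ℓ 0ℓ
maps a b = DecSetoid.setoid (≗-decSetoid a (Fin b) Fin._≟_)

-- allMaps builds its maps by pattern lambdas, so a map is only found up to pointwise equality.
_∈≗_ : ∀ {a} {B : Set} → (Fin a → B) → List (Fin a → B) → Set
f ∈≗ fs = Any (f ≗_) fs

Unique≗ : ∀ {a} {B : Set} → List (Fin a → B) → Set
Unique≗ = AllPairs (λ f g → ¬ f ≗ g)

concatMap-map≡cartesianProductWith : ∀ {A B C : Set} (h : A → B → C) xs ys →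
  concatMap (λ x → map (h x) ys) xs ≡ cartesianProductWith h xs ys
concatMap-map≡cartesianProductWith h []       ys = refl
concatMap-map≡cartesianProductWith h (x ∷ xs) ys =
  cong (map (h x) ys ++_) (concatMap-map≡cartesianProductWith h xs ys)

allMaps-complete : ∀ a b (f : Fin a → Fin b) → f ∈≗ allMaps a b
allMaps-complete zero    b f = here (λ ())
allMaps-complete (suc a) b f =
  subst (f ∈≗_) (sym (concatMap-map≡cartesianProductWith _ (allFin b) (allMaps a b)))
    (MembershipₛProperties.∈-resp-≈ (maps (suc a) b)
      (λ { zero → refl ; (suc i) → refl })
      (MembershipₛProperties.∈-cartesianProductWith⁺ (≡.setoid (Fin b))
        (maps a b) (maps (suc a) b)
        (λ { refl g≗h zero → refl ; refl g≗h (suc i) → g≗h i })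
        (∈.∈-allFin (f zero)) (allMaps-complete a b (f ∘ suc))))

allMaps-unique : ∀ a b → Unique≗ (allMaps a b)
allMaps-unique zero    b = [] ∷ []
allMaps-unique (suc a) b =
  subst Unique≗ (sym (concatMap-map≡cartesianProductWith _ (allFin b) (allMaps a b)))
    (UniqueₛProperties.cartesianProductWith⁺ (≡.setoid (Fin b))
      (maps a b) (maps (suc a) b)
      _ (λ f≗g → f≗g zero , f≗g ∘ suc) (Unique.allFin⁺ b) (allMaps-unique a b))

IsHom : (G H : Graph) → (Fin (n G) → Fin (n H)) → Set
IsHom G H f = ∀ u v → Adj G u v → Adj H (f u) (f v)

module _ {A : Set} (p : A → Bool) where

  allB-true⁻ : ∀ xs → allB p xs ≡ true → ∀ {x} → x ∈ xs → p x ≡ true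
  allB-true⁻ (y ∷ xs) h x∈ with p y in py
  allB-true⁻ (y ∷ xs) h (here refl) | true = py
  allB-true⁻ (y ∷ xs) h (there x∈)  | true = allB-true⁻ xs h x∈

  allB-true⁺ : ∀ xs → (∀ {x} → x ∈ xs → p x ≡ true) → allB p xs ≡ true
  allB-true⁺ []       _   = refl
  allB-true⁺ (y ∷ xs) all rewrite all (here refl) = allB-true⁺ xs (all ∘ there)

module _ (G H : Graph) where

  isHom⇒IsHom : ∀ f → isHom G H f ≡ true → IsHom G H f
  isHom⇒IsHom f h u v uv with allB-true⁻ _ (allFin (n G))
                               (allB-true⁻ _ (allFin (n G)) h (∈.∈-allFin u)) (∈.∈-allFin v)
  ... | holds rewrite uv = holds

  IsHom⇒isHom : ∀ f → IsHom G H f → isHom G H f ≡ true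
  IsHom⇒isHom f hom = allB-true⁺ _ (allFin (n G)) λ {u} _ → allB-true⁺ _ (allFin (n G)) λ {v} _ → edge u v
    where
      edge : ∀ u v → not (adj G u v) ∨ adj H (f u) (f v) ≡ true
      edge u v with adj G u v in uv
      ... | true  = hom u v uv
      ... | false = refl

  IsHom-resp-≗ : ∀ {f g} → f ≗ g → IsHom G H f → IsHom G H g
  IsHom-resp-≗ f≗g hom u v uv = subst₂ (Adj H) (f≗g u) (f≗g v) (hom u v uv)

  ∈-homs⁻ : ∀ {f} → f ∈ homs G H → IsHom G H f
  ∈-homs⁻ {f} f∈ =
    isHom⇒IsHom f (proj₂ (∈.∈-filter⁻ (λ f → isHom G H f Bool.≟ true) {xs = allMaps (n G) (n H)} f∈))

  homs-complete : ∀ {f} → IsHom G H f → f ∈≗ homs G H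
  homs-complete {f} hom = MembershipₛProperties.∈-filter⁺ (maps (n G) (n H))
    (λ f → isHom G H f Bool.≟ true)
    (λ {g} {h} g≗h g-hom → IsHom⇒isHom h (IsHom-resp-≗ g≗h (isHom⇒IsHom g g-hom)))
    (allMaps-complete (n G) (n H) f) (IsHom⇒isHom f hom)

  homs-unique : Unique≗ (homs G H)
  homs-unique = AllPairs.filter⁺ _ (allMaps-unique (n G) (n H))

module _ {a b : ℕ} where

  parts : (Fin a → Fin b) → List ℕ
  parts f = filter (1 ≤?_) (map (fibre f) (allFin b))

  image : (Fin a → Fin b) → List (Fin b)
  image f = filter (λ w → Fin.any? (λ u → f u Fin.≟ w)) (allFin b)

  image-unique : ∀ (f : Fin a → Fin b) → Unique (image f)
  image-unique f = Unique.filter⁺ _ (Unique.allFin⁺ b)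

  ∈-image⁺ : ∀ (f : Fin a → Fin b) u → f u ∈ image f
  ∈-image⁺ f u = ∈.∈-filter⁺ (λ w → Fin.any? (λ u → f u Fin.≟ w)) (∈.∈-allFin (f u)) (u , refl)

  ∈-image⁻ : ∀ (f : Fin a → Fin b) {w} → w ∈ image f → ∃[ u ] f u ≡ w
  ∈-image⁻ f w∈ = proj₂ (∈.∈-filter⁻ (λ w → Fin.any? (λ u → f u Fin.≟ w)) {xs = allFin b} w∈)

  image-cong : ∀ {f g : Fin a → Fin b} → f ≗ g → image f ≡ image g
  image-cong {f} {g} f≗g =
    List.filter-≐ (λ w → Fin.any? (λ u → f u Fin.≟ w)) (λ w → Fin.any? (λ u → g u Fin.≟ w))
    ((λ { (u , fu≡w) → u , trans (sym (f≗g u)) fu≡w }) , (λ { (u , gu≡w) → u , trans (f≗g u) gu≡w }))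
    (allFin b)

  length-image-≤ : ∀ (f : Fin a → Fin b) → length (image f) ≤ b
  length-image-≤ f = ≤-trans (List.length-filter _ (allFin b)) (≤-reflexive (List.length-tabulate id))

  1≤fibre⇔ : ∀ (f : Fin a → Fin b) w → 1 ≤ fibre f w ⇔ (∃[ u ] f u ≡ w)
  1≤fibre⇔ f w = mk⇔
    (λ 1≤ → let u , _ , fu≡w = nonempty-filter (λ u → f u Fin.≟ w) (allFin a) 1≤ in u , fu≡w)
    (λ { (u , fu≡w) → List.filter-some (λ u → f u Fin.≟ w) (Any.map (λ { refl → fu≡w }) (∈.∈-allFin u)) })

  length-typeOf : ∀ (f : Fin a → Fin b) → length (typeOf f) ≡ length (image f)
  length-typeOf f = begin
    length (typeOf f)                                  ≡⟨ Perm.↭-length (Sort.sort-↭ (parts f)) ⟩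
    length (parts f)                                   ≡⟨ length-filter-map (1 ≤?_) (fibre {a} {b} f) (allFin b) ⟩
    length (filter (λ w → 1 ≤? fibre f w) (allFin b))  ≡⟨ cong length (List.filter-≐ _ _ hit⇔ (allFin b)) ⟩
    length (image f)                                   ∎
    where
      open ≡-Reasoning
      hit⇔ : (λ w → 1 ≤ fibre f w) ≐ (λ w → ∃[ u ] f u ≡ w)
      hit⇔ = (λ {w} → Equivalence.to (1≤fibre⇔ f w)) , (λ {w} → Equivalence.from (1≤fibre⇔ f w))

  typeOf-cong : ∀ {f g : Fin a → Fin b} → f ≗ g → typeOf f ≡ typeOf g
  typeOf-cong {f} {g} f≗g =
    cong (λ ks → sort (filter (1 ≤?_) ks)) (List.map-cong {f = fibre f} {g = fibre g} fibre≗ (allFin b))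
    where
      fibre≗ : ∀ w → fibre f w ≡ fibre g w
      fibre≗ w = cong length (List.filter-≐ (λ u → f u Fin.≟ w) (λ u → g u Fin.≟ w)
        ((λ fu≡w → trans (sym (f≗g _)) fu≡w) , (λ gu≡w → trans (f≗g _) gu≡w)) (allFin a))

  typeOf-partition : ∀ (f : Fin a → Fin b) → IsPartition (typeOf f)
  typeOf-partition f = Sort.sort-↗ (parts f) ,
    Perm.All-resp-↭ (Perm.↭-sym (Sort.sort-↭ (parts f))) (AllP.all-filter (1 ≤?_) (map (fibre f) (allFin b)))

  typeOf-≤ : ∀ (f : Fin a → Fin b) → All (_≤ a) (typeOf f)
  typeOf-≤ f = Perm.All-resp-↭ (Perm.↭-sym (Sort.sort-↭ (parts f)))
    (AllP.filter⁺ (1 ≤?_) (AllP.map⁺ (All.universal fibre≤ (allFin b))))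
    where
      fibre≤ : ∀ w → fibre f w ≤ a
      fibre≤ w = ≤-trans (List.length-filter _ (allFin a)) (≤-reflexive (List.length-tabulate id))

length-image-id : ∀ m → length (image {m} {m} id) ≡ m
length-image-id m = trans (cong length (List.filter-all (λ w → Fin.any? (λ u → u Fin.≟ w))
                                          (All.universal (λ w → w , refl) (allFin m))))
                          (List.length-tabulate id)

isPartition? : Decidable IsPartition
isPartition? ks = sorted? _≤?_ ks ×-dec All.all? (0 <?_) ks

module _ (X : Graph) where

  d-pos⁺ : ∀ {f} → IsHom X X f → 1 ≤ d X X (typeOf f)
  d-pos⁺ {f} hom = List.filter-some (λ g → List.≡-dec ℕ._≟_ (typeOf g) (typeOf f))
    (Any.map (λ f≗g → sym (typeOf-cong f≗g)) (homs-complete X X hom))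

  d-pos⁻ : ∀ {ks} → 1 ≤ d X X ks → ∃[ f ] f ∈ homs X X × typeOf f ≡ ks
  d-pos⁻ = nonempty-filter _ (homs X X)

  d-non-partition : ∀ {ks} → ¬ IsPartition ks → d X X ks ≡ 0
  d-non-partition {ks} ¬partition = cong length (List.filter-none (λ g → List.≡-dec ℕ._≟_ (typeOf g) ks)
    (All.universal (λ f type≡ → ¬partition (subst IsPartition type≡ (typeOf-partition f))) (homs X X)))

mScale≢0 : ∀ N ks → ℕ.NonZero (mScale N ks)
mScale≢0 N ks = m*n≢0 _ _ {{product≢0 (AllP.map⁺ (All.universal (λ i → r (suc i) ks !≢0) (upTo N)))}}
                          {{(N ℕ.∸ length ks) !≢0}}

-- The identity has type 1ⁿ, so Y needs an endomorphism with n X fibres.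
order-≤ : ∀ X Y → SameSelfX X Y → n X ≤ n Y
order-≤ X Y same = begin
  n X                ≡⟨ sym (length-image-id (n X)) ⟩
  length (image ι)   ≡⟨ sym (length-typeOf ι) ⟩
  length (typeOf ι)  ≡⟨ cong length (sym (proj₂ (proj₂ Y-hom))) ⟩
  length (typeOf g)  ≡⟨ length-typeOf g ⟩
  length (image g)   ≤⟨ length-image-≤ g ⟩
  n Y                ∎
  where
    open ≤-Reasoning
    ι : Fin (n X) → Fin (n X)
    ι = id
    ks = typeOf ι
    positive : ∀ m {s} → 1 ≤ m * s → 1 ≤ m
    positive (suc m) _ = s≤s z≤n
    Y-hom : ∃[ g ] g ∈ homs Y Y × typeOf g ≡ ks
    Y-hom = d-pos⁻ Y (positive (d Y Y ks) (begin
      1                      ≤⟨ d-pos⁺ X (λ _ _ uv → uv) ⟩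
      d X X ks               ≤⟨ m≤m*n _ _ {{mScale≢0 (n X) ks}} ⟩
      XCoeff X X ks          ≡⟨ same ks (typeOf-partition ι) ⟩
      XCoeff Y Y ks          ∎))
    g = proj₁ Y-hom

-- Endomorphisms with a two-vertex image

pairsUpTo : ℕ → List (List ℕ)
pairsUpTo M = cartesianProductWith (λ i j → i ∷ j ∷ []) (upTo (suc M)) (upTo (suc M))

pairsUpTo-unique : ∀ M → Unique (pairsUpTo M)
pairsUpTo-unique M =
  Unique.cartesianProductWith⁺ _ (λ { refl → refl , refl }) (Unique.upTo⁺ (suc M)) (Unique.upTo⁺ (suc M))

∈-pairsUpTo⇔ : ∀ M {ks} → All (_≤ M) ks → ks ∈ pairsUpTo M ⇔ (length ks ≡ 2)
∈-pairsUpTo⇔ M {ks} ks≤M = mk⇔ length≡2 (pair∈ ks≤M)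
  where
    length≡2 : ks ∈ pairsUpTo M → length ks ≡ 2
    length≡2 ks∈ with ∈.∈-cartesianProductWith⁻ _ (upTo (suc M)) (upTo (suc M)) ks∈
    ... | _ , _ , _ , _ , refl = refl
    pair∈ : ∀ {ks} → All (_≤ M) ks → length ks ≡ 2 → ks ∈ pairsUpTo M
    pair∈ (i≤M ∷ j≤M ∷ []) _ = ∈.∈-cartesianProductWith⁺ _ (∈.∈-upTo⁺ (s≤s i≤M)) (∈.∈-upTo⁺ (s≤s j≤M))

module _ (X : Graph) where

  homs₂ : List (Fin (n X) → Fin (n X))
  homs₂ = filter (λ f → length (image f) ℕ.≟ 2) (homs X X)

  ∈-homs₂⁻ : ∀ {f} → f ∈ homs₂ → IsHom X X f × length (image f) ≡ 2
  ∈-homs₂⁻ f∈ = let f∈homs , two = ∈.∈-filter⁻ (λ f → length (image f) ℕ.≟ 2) {xs = homs X X} f∈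
                in ∈-homs⁻ X X f∈homs , two

  homs₂-complete : ∀ {f} → IsHom X X f → length (image f) ≡ 2 → f ∈≗ homs₂
  homs₂-complete hom two = MembershipₛProperties.∈-filter⁺ (maps (n X) (n X))
    (λ f → length (image f) ℕ.≟ 2) (λ f≗g two → trans (cong length (sym (image-cong f≗g))) two)
    (homs-complete X X hom) two

  ∈≗-homs₂⁻ : ∀ {f} → f ∈≗ homs₂ → IsHom X X f × length (image f) ≡ 2
  ∈≗-homs₂⁻ f∈ with find f∈
  ... | g , g∈ , f≗g = let hom , two = ∈-homs₂⁻ g∈ in
    IsHom-resp-≗ X X (λ v → sym (f≗g v)) hom , trans (cong length (image-cong f≗g)) two

  homs₂-unique : Unique≗ homs₂
  homs₂-unique = AllPairs.filter⁺ _ (homs-unique X X)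

  length-homs₂ : length homs₂ ≡ sum (map (d X X) (pairsUpTo (n X)))
  length-homs₂ = begin
    length homs₂
      ≡⟨ length-filter≡countᵇ _ (homs X X) ⟩
    countᵇ (λ f → does (length (image f) ℕ.≟ 2)) (homs X X)
      ≡⟨ countᵇ-cong _ _ (homs X X)
           (λ f → does-⇔ (two⇔pair f) (length (image f) ℕ.≟ 2) (typeOf f ∈? pairsUpTo (n X))) ⟩
    countᵇ (λ f → does (typeOf f ∈? pairsUpTo (n X))) (homs X X)
      ≡⟨ sym (sum-countᵇ (List.≡-dec ℕ._≟_) typeOf (pairsUpTo (n X)) (pairsUpTo-unique (n X)) (homs X X)) ⟩
    sum (map (λ ks → countᵇ (λ f → does (List.≡-dec ℕ._≟_ (typeOf f) ks)) (homs X X)) (pairsUpTo (n X)))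
      ≡⟨ cong sum (List.map-cong (λ ks → sym (length-filter≡countᵇ _ (homs X X))) (pairsUpTo (n X))) ⟩
    sum (map (d X X) (pairsUpTo (n X))) ∎
    where
      open ≡-Reasoning
      open import Data.List.Membership.DecPropositional (List.≡-dec ℕ._≟_) using (_∈?_)
      two⇔pair : ∀ f → (length (image f) ≡ 2) ⇔ (typeOf f ∈ pairsUpTo (n X))
      two⇔pair f = mk⇔
        (λ two → Equivalence.from (∈-pairsUpTo⇔ (n X) (typeOf-≤ f)) (trans (length-typeOf f) two))
        (λ pair → trans (sym (length-typeOf f)) (Equivalence.to (∈-pairsUpTo⇔ (n X) (typeOf-≤ f)) pair))

module SameSelfChromatic (T G : Graph) (same : SameSelfX T G) where

  same-order : n T ≡ n G
  same-order = ≤-antisym (order-≤ T G same) (order-≤ G T (λ ks p → sym (same ks p)))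

  same-type-counts : ∀ ks → d T T ks ≡ d G G ks
  same-type-counts ks with isPartition? ks
  ... | no ¬partition = trans (d-non-partition T ¬partition) (sym (d-non-partition G ¬partition))
  ... | yes partition = *-cancelʳ-≡ _ _ (mScale (n T) ks) {{mScale≢0 (n T) ks}}
                          (trans (same ks partition) (cong (λ m → d G G ks * mScale m ks) (sym same-order)))

  same-homs₂-count : length (homs₂ T) ≡ length (homs₂ G)
  same-homs₂-count = begin
    length (homs₂ T)                           ≡⟨ length-homs₂ T ⟩
    sum (map (d T T) (pairsUpTo (n T)))        ≡⟨ cong sum (List.map-cong same-type-counts (pairsUpTo (n T))) ⟩
    sum (map (d G G) (pairsUpTo (n T)))        ≡⟨ cong (λ m → sum (map (d G G) (pairsUpTo m))) same-order ⟩
    sum (map (d G G) (pairsUpTo (n G)))        ≡⟨ sym (length-homs₂ G) ⟩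
    length (homs₂ G)                           ∎
    where open ≡-Reasoning

module _ (X : Graph) where
  private
    V = Fin (n X)

  Adj⇒≢ : ∀ {u v} → Adj X u v → u ≢ v
  Adj⇒≢ {u} uv refl with trans (sym uv) (irrefl X u)
  ... | ()

  Adj-sym : ∀ {u v} → Adj X u v → Adj X v u
  Adj-sym {u} {v} uv = trans (symm X v u) uv

  IsEdge : V × V → Set
  IsEdge (u , v) = toℕ u < toℕ v × Adj X u v

  isEdge? : Decidable IsEdge
  isEdge? (u , v) = (toℕ u <? toℕ v) ×-dec (adj X u v Bool.≟ true)

  edges : List (V × V)
  edges = filter isEdge? (cartesianProduct (allFin (n X)) (allFin (n X)))

  edges-unique : Unique edges
  edges-unique = Unique.filter⁺ isEdge? (Unique.cartesianProduct⁺ (Unique.allFin⁺ (n X)) (Unique.allFin⁺ (n X)))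

  ∈-edges⁻ : ∀ {e} → e ∈ edges → IsEdge e
  ∈-edges⁻ e∈ = proj₂ (∈.∈-filter⁻ isEdge? {xs = cartesianProduct (allFin (n X)) (allFin (n X))} e∈)

  ∈-edges⁺ : ∀ {u v} → toℕ u < toℕ v → Adj X u v → (u , v) ∈ edges
  ∈-edges⁺ {u} {v} u<v uv =
    ∈.∈-filter⁺ isEdge? (∈.∈-cartesianProduct⁺ (∈.∈-allFin u) (∈.∈-allFin v)) (u<v , uv)

  Adj⇒∈-edges : ∀ {u v} → Adj X u v → (u , v) ∈ edges ⊎ (v , u) ∈ edges
  Adj⇒∈-edges {u} {v} uv with <-cmp (toℕ u) (toℕ v)
  ... | tri< u<v _ _ = inj₁ (∈-edges⁺ u<v uv)
  ... | tri> _ _ v<u = inj₂ (∈-edges⁺ v<u (Adj-sym uv))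
  ... | tri≈ _ u≡v _ = ⊥-elim (Adj⇒≢ uv (Fin.toℕ-injective u≡v))

  arcs : List (V × V)
  arcs = edges ++ map swap edges

  length-arcs : length arcs ≡ length edges * 2
  length-arcs = begin
    length (edges ++ map swap edges)           ≡⟨ List.length-++ edges ⟩
    length edges + length (map swap edges)     ≡⟨ cong (length edges +_) (List.length-map swap edges) ⟩
    length edges + length edges                ≡⟨ solve ⟩
    length edges * 2                           ∎
    where
      open ≡-Reasoning
      solve : length edges + length edges ≡ length edges * 2
      solve = trans (cong (length edges +_) (sym (+-identityʳ _))) (*-comm 2 (length edges))

  arcs-unique : Unique arcs
  arcs-unique = Unique.++⁺ edges-unique (Unique.map⁺ swap-injective edges-unique) disjoint
    where
      swap-injective : ∀ {e f : V × V} → swap e ≡ swap f → e ≡ f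
      swap-injective {_ , _} {_ , _} refl = refl
      disjoint : ∀ {e} → e ∈ edges × e ∈ map swap edges → ⊥
      disjoint (e∈ , e∈swapped) with ∈.∈-map⁻ swap e∈swapped
      ... | _ , f∈ , refl = <-asym (proj₁ (∈-edges⁻ e∈)) (proj₁ (∈-edges⁻ f∈))

  ∈-arcs⁻ : ∀ {u v} → (u , v) ∈ arcs → Adj X u v
  ∈-arcs⁻ uv∈ with ∈.∈-++⁻ edges uv∈
  ... | inj₁ uv∈edges = proj₂ (∈-edges⁻ uv∈edges)
  ... | inj₂ uv∈swapped with ∈.∈-map⁻ swap uv∈swapped
  ...   | _ , vu∈ , refl = Adj-sym (proj₂ (∈-edges⁻ vu∈))

  Adj⇒∈-arcs : ∀ {u v} → Adj X u v → (u , v) ∈ arcs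
  Adj⇒∈-arcs uv with Adj⇒∈-edges uv
  ... | inj₁ uv∈ = ∈.∈-++⁺ˡ uv∈
  ... | inj₂ vu∈ = ∈.∈-++⁺ʳ edges (∈.∈-map⁺ swap vu∈)

module _ {a b : ℕ} (f : Fin a → Fin b) where

  2≤length-image : ∀ {u v} → f u ≢ f v → 2 ≤ length (image f)
  2≤length-image fu≢fv = unique-⊆⇒length-≤ Fin._≟_ (image f) (_ ∷ _ ∷ [])
    ((fu≢fv ∷ []) ∷ [] ∷ []) (λ { (here refl) → ∈-image⁺ f _ ; (there (here refl)) → ∈-image⁺ f _ })

  length-image-const : ∀ {v} → (∀ u → f u ≡ f v) → length (image f) ≡ 1
  length-image-const {v} const = ≤-antisym
    (unique-⊆⇒length-≤ Fin._≟_ (f v ∷ []) (image f) (image-unique f)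
       (λ w∈ → let u , fu≡w = ∈-image⁻ f w∈ in here (trans (sym fu≡w) (const u))))
    (unique-⊆⇒length-≤ Fin._≟_ (image f) (f v ∷ []) ([] ∷ []) (λ { (here refl) → ∈-image⁺ f v }))

  two-valued : length (image f) ≡ 2 → ∀ {u v} → f u ≢ f v → ∀ w → f w ≡ f u ⊎ f w ≡ f v
  two-valued two {u} {v} fu≢fv w with f w Fin.≟ f u | f w Fin.≟ f v
  ... | yes fw≡fu | _          = inj₁ fw≡fu
  ... | no  _     | yes fw≡fv  = inj₂ fw≡fv
  ... | no  fw≢fu | no  fw≢fv  with subst (3 ≤_) two (unique-⊆⇒length-≤ Fin._≟_ (image f) (_ ∷ _ ∷ _ ∷ [])
          ((fu≢fv ∷ (fw≢fu ∘ sym) ∷ []) ∷ ((fw≢fv ∘ sym) ∷ []) ∷ [] ∷ [])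
          (λ { (here refl)                → ∈-image⁺ f u
             ; (there (here refl))        → ∈-image⁺ f v
             ; (there (there (here refl))) → ∈-image⁺ f w }))
  ...   | s≤s (s≤s ())

ProperColouring : (X : Graph) → (Fin (n X) → Bool) → Set
ProperColouring X κ = ∀ u v → Adj X u v → κ u ≢ κ v

colourMap : ∀ {a b} → Fin b → Fin b → (Fin a → Bool) → Fin a → Fin b
colourMap x y κ v = if κ v then x else y

module _ (X : Graph) {x y : Fin (n X)} (κ : Fin (n X) → Bool) where

  colourMap-hom : Adj X x y → ProperColouring X κ → IsHom X X (colourMap x y κ)
  colourMap-hom xy proper u v uv with κ u | κ v | proper u v uv
  ... | true  | true  | κu≢κv = ⊥-elim (κu≢κv refl)
  ... | true  | false | _     = xy
  ... | false | true  | _     = Adj-sym X xy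
  ... | false | false | κu≢κv = ⊥-elim (κu≢κv refl)

  length-image-colourMap : x ≢ y → ∀ {u v} → κ u ≢ κ v → length (image (colourMap x y κ)) ≡ 2
  length-image-colourMap x≢y {u} {v} κu≢κv = ≤-antisym
    (unique-⊆⇒length-≤ Fin._≟_ (x ∷ y ∷ []) (image (colourMap x y κ)) (image-unique _) ⊆xy)
    (2≤length-image (colourMap x y κ) separated)
    where
      separated : colourMap x y κ u ≢ colourMap x y κ v
      separated with κ u | κ v
      ... | true  | true  = ⊥-elim (κu≢κv refl)
      ... | true  | false = x≢y
      ... | false | true  = x≢y ∘ sym
      ... | false | false = ⊥-elim (κu≢κv refl)
      ⊆xy : ∀ {w} → w ∈ image (colourMap x y κ) → w ∈ x ∷ y ∷ []
      ⊆xy w∈ with ∈-image⁻ (colourMap x y κ) w∈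
      ... | w′ , refl with κ w′
      ...   | true  = here refl
      ...   | false = there (here refl)

module _ {k m} (x y : Fin m) (κ : Fin k → Bool) where

  colourMap-true : ∀ {u} → κ u ≡ true → colourMap x y κ u ≡ x
  colourMap-true κu rewrite κu = refl

  colourMap-false : ∀ {u} → κ u ≡ false → colourMap x y κ u ≡ y
  colourMap-false κu rewrite κu = refl

colourMap-injective : ∀ {k m} {x y x′ y′ : Fin m} {κ κ′ : Fin k → Bool} {v z} → x ≢ y →
  κ v ≡ true → κ′ v ≡ true → κ z ≡ false → colourMap x y κ ≗ colourMap x′ y′ κ′ →
  (x , y) ≡ (x′ , y′) × κ ≗ κ′
colourMap-injective {x = x} {y} {x′} {y′} {κ} {κ′} {v} {z} x≢y κv κ′v κz same =
  cong₂ _,_ x≡x′ y≡y′ , κ≗κ′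
  where
    x≡x′ : x ≡ x′
    x≡x′ = trans (sym (colourMap-true x y κ κv)) (trans (same v) (colourMap-true x′ y′ κ′ κ′v))
    y≡y′ : y ≡ y′
    y≡y′ with κ′ z in κ′z
    ... | true  = ⊥-elim (x≢y (trans x≡x′ (sym (trans (sym (colourMap-false x y κ κz))
                    (trans (same z) (colourMap-true x′ y′ κ′ κ′z))))))
    ... | false = trans (sym (colourMap-false x y κ κz)) (trans (same z) (colourMap-false x′ y′ κ′ κ′z))
    κ≗κ′ : κ ≗ κ′
    κ≗κ′ u with κ u in κu | κ′ u in κ′u
    ... | true  | true  = refl
    ... | false | false = refl
    ... | true  | false = ⊥-elim (x≢y (trans (sym (colourMap-true x y κ κu))
                            (trans (same u) (trans (colourMap-false x′ y′ κ′ κ′u) (sym y≡y′)))))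
    ... | false | true  = ⊥-elim (x≢y (sym (trans (sym (colourMap-false x y κ κu))
                            (trans (same u) (trans (colourMap-true x′ y′ κ′ κ′u) (sym x≡x′))))))

colouring-from-homs₂ : ∀ (X : Graph) {f} → IsHom X X f → length (image f) ≡ 2 → ∀ b →
  Σ (Fin (n X) → Bool) λ κ → κ b ≡ true × ProperColouring X κ
colouring-from-homs₂ X {f} hom two b = (λ v → does (f v Fin.≟ f b)) , dec-true (f b Fin.≟ f b) refl , proper
  where
    proper : ProperColouring X (λ v → does (f v Fin.≟ f b))
    proper u v uv with f u Fin.≟ f b | f v Fin.≟ f b
    ... | yes fu≡fb | yes fv≡fb = λ _ → Adj⇒≢ X (hom u v uv) (trans fu≡fb (sym fv≡fb))
    ... | yes _     | no  _     = λ ()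
    ... | no  _     | yes _     = λ ()
    ... | no  fu≢fb | no  fv≢fb with two-valued f two (Adj⇒≢ X (hom u v uv)) b
    ...   | inj₁ fb≡fu = ⊥-elim (fu≢fb (sym fb≡fu))
    ...   | inj₂ fb≡fv = ⊥-elim (fv≢fb (sym fb≡fv))

-- Components by union–find

module Merging (m : ℕ) where

  Labelling : Set
  Labelling = Fin m → Fin m

  merge : Labelling → Fin m × Fin m → Labelling
  merge ℓ (u , v) w = if does (ℓ w Fin.≟ ℓ v) then ℓ u else ℓ w

  mergeAll : Labelling → List (Fin m × Fin m) → Labelling
  mergeAll = foldl merge

  merges : Labelling → List (Fin m × Fin m) → ℕ
  merges ℓ []             = 0
  merges ℓ ((u , v) ∷ ps) = (if does (ℓ u Fin.≟ ℓ v) then 0 else 1) + merges (merge ℓ (u , v)) ps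

  classes : Labelling → ℕ
  classes ℓ = length (image ℓ)

  merge-joins : ∀ ℓ u v → merge ℓ (u , v) u ≡ merge ℓ (u , v) v
  merge-joins ℓ u v with ℓ u Fin.≟ ℓ v | ℓ v Fin.≟ ℓ v
  ... | _ | no ℓv≢ℓv = ⊥-elim (ℓv≢ℓv refl)
  ... | yes _ | yes _ = refl
  ... | no  _ | yes _ = refl

  merge-resp : ∀ ℓ p {a b} → ℓ a ≡ ℓ b → merge ℓ p a ≡ merge ℓ p b
  merge-resp ℓ (u , v) ℓa≡ℓb rewrite ℓa≡ℓb = refl

  mergeAll-resp : ∀ ℓ ps {a b} → ℓ a ≡ ℓ b → mergeAll ℓ ps a ≡ mergeAll ℓ ps b
  mergeAll-resp ℓ []       ℓa≡ℓb = ℓa≡ℓb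
  mergeAll-resp ℓ (p ∷ ps) ℓa≡ℓb = mergeAll-resp (merge ℓ p) ps (merge-resp ℓ p ℓa≡ℓb)

  mergeAll-joins : ∀ ℓ ps {u v} → (u , v) ∈ ps → mergeAll ℓ ps u ≡ mergeAll ℓ ps v
  mergeAll-joins ℓ (_ ∷ ps) {u} {v} (here refl) = mergeAll-resp (merge ℓ (u , v)) ps (merge-joins ℓ u v)
  mergeAll-joins ℓ (p ∷ ps) (there uv∈) = mergeAll-joins (merge ℓ p) ps uv∈

  merge-trivial : ∀ ℓ {u v} → ℓ u ≡ ℓ v → merge ℓ (u , v) ≗ ℓ
  merge-trivial ℓ {v = v} ℓu≡ℓv w with ℓ w Fin.≟ ℓ v
  ... | yes ℓw≡ℓv = trans ℓu≡ℓv (sym ℓw≡ℓv)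
  ... | no  _     = refl

  classes-merge : ∀ ℓ {u v} → ℓ u ≢ ℓ v → suc (classes (merge ℓ (u , v))) ≡ classes ℓ
  classes-merge ℓ {u} {v} ℓu≢ℓv = trans
    (cong suc (same-members⇒length-≡ Fin._≟_ (image-unique _) (Unique.filter⁺ _ (image-unique ℓ)) ⊆rest rest⊆))
    (length-remove Fin._≟_ (image ℓ) (image-unique ℓ) (∈-image⁺ ℓ v))
    where
      rest = filter (λ w → ¬? (w Fin.≟ ℓ v)) (image ℓ)
      ⊆rest : ∀ {w} → w ∈ image (merge ℓ (u , v)) → w ∈ rest
      ⊆rest w∈ with ∈-image⁻ (merge ℓ (u , v)) w∈
      ... | x , refl with ℓ x Fin.≟ ℓ v
      ...   | yes _    = ∈.∈-filter⁺ (λ w → ¬? (w Fin.≟ ℓ v)) (∈-image⁺ ℓ u) ℓu≢ℓv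
      ...   | no ℓx≢ℓv = ∈.∈-filter⁺ (λ w → ¬? (w Fin.≟ ℓ v)) (∈-image⁺ ℓ x) ℓx≢ℓv
      rest⊆ : ∀ {w} → w ∈ rest → w ∈ image (merge ℓ (u , v))
      rest⊆ w∈ with ∈.∈-filter⁻ (λ w → ¬? (w Fin.≟ ℓ v)) {xs = image ℓ} w∈
      ... | w∈image , w≢ℓv with ∈-image⁻ ℓ w∈image
      ...   | x , refl = subst (_∈ image (merge ℓ (u , v)))
                           (cong (if_then ℓ u else ℓ x) (dec-false (ℓ x Fin.≟ ℓ v) w≢ℓv)) (∈-image⁺ _ x)

  classes-mergeAll : ∀ ℓ ps → classes (mergeAll ℓ ps) + merges ℓ ps ≡ classes ℓ
  classes-mergeAll ℓ []             = +-identityʳ _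
  classes-mergeAll ℓ ((u , v) ∷ ps) with ℓ u Fin.≟ ℓ v
  ... | yes ℓu≡ℓv = trans (classes-mergeAll (merge ℓ (u , v)) ps)
                          (cong length (image-cong (merge-trivial ℓ ℓu≡ℓv)))
  ... | no  ℓu≢ℓv = trans (+-suc _ _)
                          (trans (cong suc (classes-mergeAll (merge ℓ (u , v)) ps)) (classes-merge ℓ ℓu≢ℓv))

  merges-≤ : ∀ ℓ ps → merges ℓ ps ≤ length ps
  merges-≤ ℓ []             = z≤n
  merges-≤ ℓ ((u , v) ∷ ps) with does (ℓ u Fin.≟ ℓ v)
  ... | true  = m≤n⇒m≤1+n (merges-≤ _ ps)
  ... | false = s≤s (merges-≤ _ ps)

  module _ {R : Fin m → Fin m → Set} (R-sym : ∀ {a b} → R a b → R b a) where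

    LabelsConnected : Labelling → Set
    LabelsConnected ℓ = ∀ a b → ℓ a ≡ ℓ b → Star R a b

    id-connected : LabelsConnected id
    id-connected a .a refl = ε

    merge-connected : ∀ ℓ {u v} → R u v → LabelsConnected ℓ → LabelsConnected (merge ℓ (u , v))
    merge-connected ℓ {u} {v} uv conn a b ℓ′a≡ℓ′b with ℓ a Fin.≟ ℓ v | ℓ b Fin.≟ ℓ v
    ... | yes ℓa≡ℓv | yes ℓb≡ℓv = conn a b (trans ℓa≡ℓv (sym ℓb≡ℓv))
    ... | yes ℓa≡ℓv | no  _     = conn a v ℓa≡ℓv ◅◅ (R-sym uv ◅ conn u b ℓ′a≡ℓ′b)
    ... | no  _     | yes ℓb≡ℓv = conn a u ℓ′a≡ℓ′b ◅◅ (uv ◅ conn v b (sym ℓb≡ℓv))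
    ... | no  _     | no  _     = conn a b ℓ′a≡ℓ′b

    mergeAll-connected : ∀ ℓ ps → All (λ p → R (proj₁ p) (proj₂ p)) ps → LabelsConnected ℓ →
                         LabelsConnected (mergeAll ℓ ps)
    mergeAll-connected ℓ []             []         conn = conn
    mergeAll-connected ℓ ((u , v) ∷ ps) (uv ∷ Rps) conn =
      mergeAll-connected (merge ℓ (u , v)) ps Rps (merge-connected ℓ uv conn)

  EveryStepMerges : Labelling → List (Fin m × Fin m) → Set
  EveryStepMerges ℓ []             = ⊤
  EveryStepMerges ℓ ((u , v) ∷ ps) = ℓ u ≢ ℓ v × EveryStepMerges (merge ℓ (u , v)) ps

  merges-every-step : ∀ ℓ ps → EveryStepMerges ℓ ps → merges ℓ ps ≡ length ps
  merges-every-step ℓ []             _               = refl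
  merges-every-step ℓ ((u , v) ∷ ps) (ℓu≢ℓv , steps) rewrite dec-false (ℓ u Fin.≟ ℓ v) ℓu≢ℓv =
    cong suc (merges-every-step (merge ℓ (u , v)) ps steps)

  recolour : Labelling → (Fin m → Bool) → Fin m × Fin m → Fin m → Bool
  recolour ℓ κ (u , v) w = if does (ℓ w Fin.≟ ℓ v) ∧ does (κ u Bool.≟ κ v) then not (κ w) else κ w

  recolour-resp : ∀ ℓ κ p {a b} → ℓ a ≡ ℓ b → κ a ≢ κ b → recolour ℓ κ p a ≢ recolour ℓ κ p b
  recolour-resp ℓ κ (u , v) {a} {b} ℓa≡ℓb κa≢κb rewrite ℓa≡ℓb
    with does (ℓ b Fin.≟ ℓ v) ∧ does (κ u Bool.≟ κ v)
  ... | true  = κa≢κb ∘ Bool.not-injective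
  ... | false = κa≢κb

  recolour-separates : ∀ ℓ κ {u v} → ℓ u ≢ ℓ v → recolour ℓ κ (u , v) u ≢ recolour ℓ κ (u , v) v
  recolour-separates ℓ κ {u} {v} ℓu≢ℓv
    rewrite dec-false (ℓ u Fin.≟ ℓ v) ℓu≢ℓv | dec-true (ℓ v Fin.≟ ℓ v) refl with κ u | κ v
  ... | false | false = λ ()
  ... | false | true  = λ ()
  ... | true  | false = λ ()
  ... | true  | true  = λ ()

  colouring-along : ∀ ℓ κ ps → EveryStepMerges ℓ ps → Σ (Fin m → Bool) λ κ′ →
    (∀ {a b} → ℓ a ≡ ℓ b → κ a ≢ κ b → κ′ a ≢ κ′ b) × (∀ {a b} → (a , b) ∈ ps → κ′ a ≢ κ′ b)
  colouring-along ℓ κ []             _               = κ , (λ _ κa≢κb → κa≢κb) , λ ()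
  colouring-along ℓ κ ((u , v) ∷ ps) (ℓu≢ℓv , steps)
    with colouring-along (merge ℓ (u , v)) (recolour ℓ κ (u , v)) ps steps
  ... | κ′ , keeps , proper = κ′ , keeps′ , proper′
    where
      keeps′ : ∀ {a b} → ℓ a ≡ ℓ b → κ a ≢ κ b → κ′ a ≢ κ′ b
      keeps′ ℓa≡ℓb κa≢κb = keeps (merge-resp ℓ (u , v) ℓa≡ℓb) (recolour-resp ℓ κ (u , v) ℓa≡ℓb κa≢κb)
      proper′ : ∀ {a b} → (a , b) ∈ (u , v) ∷ ps → κ′ a ≢ κ′ b
      proper′ (here refl) = keeps (merge-joins ℓ u v) (recolour-separates ℓ κ ℓu≢ℓv)
      proper′ (there ab∈) = proper ab∈

data Walk {V : Set} (R : V → V → Set) : V → V → List V → Set where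
  stop : ∀ {x} → Walk R x x (x ∷ [])
  step : ∀ {x z y vs} → R x z → Walk R z y vs → Walk R x y (x ∷ vs)

chain : ∀ {A : Set} {R : A → A → Set} N (g : Fin (suc N) → A) →
        (∀ i → R (g (inject₁ i)) (g (suc i))) → Star R (g zero) (g (fromℕ N))
chain zero    g steps = ε
chain (suc N) g steps = steps zero ◅ chain N (g ∘ suc) (steps ∘ suc)

module _ {m : ℕ} {R : Fin m → Fin m → Set} where
  open import Data.List.Membership.DecPropositional (Fin._≟_ {m}) using (_∈?_)

  private
    suffix : ∀ {z y vs x} → Walk R z y vs → Unique vs → x ∈ vs → ∃[ ws ] Walk R x y ws × Unique ws
    suffix stop              vs! (here refl) = _ , stop , vs!
    suffix (step r w)        vs! (here refl) = _ , step r w , vs!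
    suffix (step r w) (_ ∷ vs!) (there x∈)  = suffix w vs! x∈

  loop-erased : ∀ {x y} → Star R x y → ∃[ vs ] Walk R x y vs × Unique vs
  loop-erased ε = _ , stop , [] ∷ []
  loop-erased {x} (r ◅ rs) with loop-erased rs
  ... | vs , w , vs! with x ∈? vs
  ...   | yes x∈ = suffix w vs! x∈
  ...   | no  x∉ = x ∷ vs , step r w , All.tabulate (λ y∈ x≡y → x∉ (subst (_∈ vs) (sym x≡y) y∈)) ∷ vs!

module _ (X : Graph) {R : Fin (n X) → Fin (n X) → Set} (R⊆Adj : ∀ {a b} → R a b → Adj X a b) where

  private
    walk-steps : ∀ {x y ws} → Walk R x y (x ∷ ws) → ∀ (i : Fin (length ws)) →
                 Adj X (lookup (x ∷ ws) (inject₁ i)) (lookup ws i)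
    walk-steps (step r stop)           zero    = R⊆Adj r
    walk-steps (step r (step _ _))     zero    = R⊆Adj r
    walk-steps (step r w@(step _ _))   (suc i) = walk-steps w i

    walk-end : ∀ {x y ws} → Walk R x y (x ∷ ws) → lookup (x ∷ ws) (fromℕ (length ws)) ≡ y
    walk-end stop                 = refl
    walk-end (step r stop)        = refl
    walk-end (step r w@(step _ _)) = walk-end w

    lookup-injective : ∀ {A : Set} (xs : List A) → Unique xs → ∀ {i j} → lookup xs i ≡ lookup xs j → i ≡ j
    lookup-injective (x ∷ xs) _          {zero}  {zero}  _ = refl
    lookup-injective (x ∷ xs) (x∉ ∷ _)   {zero}  {suc j} e = ⊥-elim (All.lookup x∉ (∈.∈-lookup j) e)
    lookup-injective (x ∷ xs) (x∉ ∷ _)   {suc i} {zero}  e = ⊥-elim (All.lookup x∉ (∈.∈-lookup i) (sym e))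
    lookup-injective (x ∷ xs) (_ ∷ xs!)  {suc i} {suc j} e = cong suc (lookup-injective xs xs! e)

  cycle : ∀ {u v a b rest} → Walk R u v (u ∷ a ∷ b ∷ rest) → Unique (u ∷ a ∷ b ∷ rest) → Adj X v u →
          HasCycle X
  cycle {u} {v} {a} {b} {rest} w vs! vu =
    length rest , lookup (u ∷ a ∷ b ∷ rest) , lookup-injective _ vs! , walk-steps w ,
    subst (λ z → Adj X z u) (sym (walk-end w)) vu

Linked : ∀ {V : Set} → List (V × V) → V → V → Set
Linked ps a b = (a , b) ∈ ps ⊎ (b , a) ∈ ps

Linked-sym : ∀ {V : Set} {ps : List (V × V)} {a b} → Linked ps a b → Linked ps b a
Linked-sym (inj₁ ab∈) = inj₂ ab∈
Linked-sym (inj₂ ba∈) = inj₁ ba∈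

module Components (X : Graph) where
  open Merging (n X) public

  mergeAll-Linked : ∀ ps {a b} → Linked ps a b → mergeAll id ps a ≡ mergeAll id ps b
  mergeAll-Linked ps (inj₁ ab∈) = mergeAll-joins id ps ab∈
  mergeAll-Linked ps (inj₂ ba∈) = sym (mergeAll-joins id ps ba∈)

  component : Labelling
  component = mergeAll id (edges X)

  component-walk : ∀ {a b} → Star (Adj X) a b → component a ≡ component b
  component-walk ε        = refl
  component-walk (ab ◅ w) = trans (mergeAll-Linked (edges X) (Adj⇒∈-edges X ab)) (component-walk w)

  walk-component : ∀ a b → component a ≡ component b → Star (Adj X) a b
  walk-component = mergeAll-connected (Adj-sym X) id (edges X)
    (All.tabulate (λ e∈ → proj₂ (∈-edges⁻ X e∈))) (id-connected (Adj-sym X))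

  components+merges : ∀ ps → classes (mergeAll id ps) + merges id ps ≡ n X
  components+merges ps = trans (classes-mergeAll id ps) (length-image-id (n X))

  order-≤-spanning : Connected X → ∀ ps → (∀ {a b} → Adj X a b → Star (Linked ps) a b) →
                     n X ≤ suc (length ps)
  order-≤-spanning (0<n , walks) ps spans = begin
    n X                                      ≡⟨ sym (components+merges ps) ⟩
    classes (mergeAll id ps) + merges id ps  ≡⟨ cong (_+ merges id ps) (length-image-const ℓ (λ u → along (walks u b))) ⟩
    suc (merges id ps)                       ≤⟨ s≤s (merges-≤ id ps) ⟩
    suc (length ps)                          ∎
    where
      open ≤-Reasoning
      ℓ = mergeAll id ps
      b = fromℕ< 0<n
      along-linked : ∀ {a c} → Star (Linked ps) a c → ℓ a ≡ ℓ c
      along-linked ε        = refl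
      along-linked (ac ◅ w) = trans (mergeAll-Linked ps ac) (along-linked w)
      along : ∀ {a c} → Star (Adj X) a c → ℓ a ≡ ℓ c
      along ε        = refl
      along (ac ◅ w) = trans (along-linked (spans ac)) (along w)

module Tree (T : Graph) (tree : IsTree T) where
  open Components T

  private
    V = Fin (n T)

    -- An edge that failed to merge would close a cycle with a path through the earlier edges.
    prefix-unlinked : ∀ pre {u v} rest → pre ++ (u , v) ∷ rest ≡ edges T → mergeAll id pre u ≢ mergeAll id pre v
    prefix-unlinked pre {u} {v} rest split same
      with loop-erased (mergeAll-connected Linked-sym id pre (All.tabulate inj₁) (id-connected Linked-sym) u v same)
    ... | _ , w , vs! = no-path w vs!
      where
        uv∈ : (u , v) ∈ edges T
        uv∈ = subst ((u , v) ∈_) split (∈.∈-++⁺ʳ pre (here refl))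
        u<v = proj₁ (∈-edges⁻ T uv∈)
        uv  = proj₂ (∈-edges⁻ T uv∈)
        pre⊆ : ∀ {e} → e ∈ pre → e ∈ edges T
        pre⊆ e∈ = subst (_ ∈_) split (∈.∈-++⁺ˡ e∈)
        uv∉pre : (u , v) ∉ pre
        uv∉pre = unique-split pre (subst Unique (sym split) (edges-unique T))
          where
            unique-split : ∀ xs {ys} → Unique (xs ++ (u , v) ∷ ys) → (u , v) ∉ xs
            unique-split (x ∷ xs) (x∉ ∷ _) (here refl) = All.lookup x∉ (∈.∈-++⁺ʳ xs (here refl)) refl
            unique-split (x ∷ xs) (_ ∷ xs!) (there e∈) = unique-split xs xs! e∈
        linked⇒Adj : ∀ {a b} → Linked pre a b → Adj T a b
        linked⇒Adj (inj₁ ab∈) = proj₂ (∈-edges⁻ T (pre⊆ ab∈))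
        linked⇒Adj (inj₂ ba∈) = Adj-sym T (proj₂ (∈-edges⁻ T (pre⊆ ba∈)))
        no-path : ∀ {vs} → Walk (Linked pre) u v vs → Unique vs → ⊥
        no-path stop                             _   = <-irrefl refl u<v
        no-path (step (inj₁ uv∈pre) stop)        _   = uv∉pre uv∈pre
        no-path (step (inj₂ vu∈pre) stop)        _   = <-asym u<v (proj₁ (∈-edges⁻ T (pre⊆ vu∈pre)))
        no-path w@(step _ (step _ stop))         vs! = proj₂ tree (cycle T linked⇒Adj w vs! (Adj-sym T uv))
        no-path w@(step _ (step _ (step _ _)))   vs! = proj₂ tree (cycle T linked⇒Adj w vs! (Adj-sym T uv))

    steps-after : ∀ pre rest → pre ++ rest ≡ edges T → EveryStepMerges (mergeAll id pre) rest
    steps-after pre []             _     = tt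
    steps-after pre ((u , v) ∷ rest) split = prefix-unlinked pre rest split ,
      subst (λ ℓ → EveryStepMerges ℓ rest) (List.foldl-++ merge id pre ((u , v) ∷ []))
        (steps-after (pre ++ (u , v) ∷ []) rest (trans (List.++-assoc pre _ rest) split))

  every-step-merges : EveryStepMerges id (edges T)
  every-step-merges = steps-after [] (edges T) refl

  order≡suc-size : n T ≡ suc (length (edges T))
  order≡suc-size = begin
    n T                                      ≡⟨ sym (components+merges (edges T)) ⟩
    classes component + merges id (edges T)  ≡⟨ cong₂ _+_ one-class (merges-every-step id (edges T) every-step-merges) ⟩
    suc (length (edges T))                   ∎
    where
      open ≡-Reasoning
      b = fromℕ< (proj₁ (proj₁ tree))
      one-class : classes component ≡ 1
      one-class = length-image-const component (λ u → component-walk (proj₂ (proj₁ tree) u b))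

  proper-colouring : Σ (V → Bool) (ProperColouring T)
  proper-colouring with colouring-along id (λ _ → true) (edges T) every-step-merges
  ... | κ , _ , proper = κ , λ u v uv → [ proper , (λ vu∈ → proper vu∈ ∘ sym) ]′ (Adj⇒∈-edges T uv)

≢-both⇒≡ : ∀ {A : Set} {p q x y z : A} → x ≡ p ⊎ x ≡ q → y ≡ p ⊎ y ≡ q → z ≡ p ⊎ z ≡ q →
           x ≢ y → x ≢ z → y ≡ z
≢-both⇒≡ _          (inj₁ refl) (inj₁ refl) _   _   = refl
≢-both⇒≡ _          (inj₂ refl) (inj₂ refl) _   _   = refl
≢-both⇒≡ (inj₁ refl) (inj₁ refl) _          x≢y _   = ⊥-elim (x≢y refl)
≢-both⇒≡ (inj₁ refl) _          (inj₁ refl) _   x≢z = ⊥-elim (x≢z refl)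
≢-both⇒≡ (inj₂ refl) (inj₂ refl) _          x≢y _   = ⊥-elim (x≢y refl)
≢-both⇒≡ (inj₂ refl) _          (inj₂ refl) _   x≢z = ⊥-elim (x≢z refl)

module _ (X : Graph) (connected : Connected X) {b w} (bw : Adj X b w) where

  -- Along an edge, both maps must leave the common value for the other point of the image.
  homs₂-agree : ∀ {f g} → IsHom X X f → length (image f) ≡ 2 → IsHom X X g → length (image g) ≡ 2 →
                f b ≡ g b → f w ≡ g w → f ≗ g
  homs₂-agree {f} {g} f-hom f-two g-hom g-two fb≡gb fw≡gw v = along (proj₂ connected b v) fb≡gb
    where
      f-values : ∀ x → f x ≡ f b ⊎ f x ≡ f w
      f-values = two-valued f f-two (Adj⇒≢ X (f-hom b w bw))
      g-values : ∀ x → g x ≡ f b ⊎ g x ≡ f w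
      g-values x with two-valued g g-two (Adj⇒≢ X (g-hom b w bw)) x
      ... | inj₁ gx≡gb = inj₁ (trans gx≡gb (sym fb≡gb))
      ... | inj₂ gx≡gw = inj₂ (trans gx≡gw (sym fw≡gw))
      along : ∀ {a c} → Star (Adj X) a c → f a ≡ g a → f c ≡ g c
      along ε        fa≡ga = fa≡ga
      along (ac ◅ p) fa≡ga = along p (≢-both⇒≡ (f-values _) (f-values _) (g-values _)
        (Adj⇒≢ X (f-hom _ _ ac)) (λ fa≡gc → Adj⇒≢ X (g-hom _ _ ac) (trans (sym fa≡ga) fa≡gc)))

  length-homs₂-≤ : length (homs₂ X) ≤ length (arcs X)
  length-homs₂-≤ = injection⇒length-≤ (maps (n X) (n X)) (≡.decSetoid (≡-dec Fin._≟_ Fin._≟_))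
    (λ f → f b , f w) (homs₂-unique X) injective into
    where
      injective : ∀ {f g} → f ∈≗ homs₂ X → g ∈≗ homs₂ X → (f b , f w) ≡ (g b , g w) → f ≗ g
      injective f∈ g∈ same-ends =
        let f-hom , f-two = ∈≗-homs₂⁻ X f∈
            g-hom , g-two = ∈≗-homs₂⁻ X g∈
        in homs₂-agree f-hom f-two g-hom g-two (cong proj₁ same-ends) (cong proj₂ same-ends)
      into : ∀ {f} → f ∈≗ homs₂ X → (f b , f w) ∈ arcs X
      into f∈ = Adj⇒∈-arcs X (proj₁ (∈≗-homs₂⁻ X f∈) b w bw)

-- Recolouring components independently

colourBound : ℕ → ℕ
colourBound 0             = 1
colourBound 1             = 2
colourBound (suc (suc r)) = 4 + r

module Recolourings (G : Graph) {b₀ w₀ : Fin (n G)} (b₀w₀ : Adj G b₀ w₀)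
                    (κ₀ : Fin (n G) → Bool) (κ₀b₀ : κ₀ b₀ ≡ true) (proper₀ : ProperColouring G κ₀) where
  open Components G

  private
    V = Fin (n G)

  flipOn : (V → Bool) → V → Bool
  flipOn S v = if S (component v) then not (κ₀ v) else κ₀ v

  flipOn-proper : ∀ S → ProperColouring G (flipOn S)
  flipOn-proper S u v uv rewrite component-walk (uv ◅ ε) with S (component v)
  ... | true  = proper₀ u v uv ∘ Bool.not-injective
  ... | false = proper₀ u v uv

  data Separates (S S′ : V → Bool) : Set where
    separated-by : ∀ u → S (component u) ≢ S′ (component u) → Separates S S′

  flipOn-injective : ∀ {S S′} → Separates S S′ → ¬ flipOn S ≗ flipOn S′
  flipOn-injective {S} {S′} (separated-by u Su≢S′u) same with S (component u) | S′ (component u) | same u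
  ... | true  | true  | _    = Su≢S′u refl
  ... | false | false | _    = Su≢S′u refl
  ... | true  | false | flip = Bool.not-¬ refl (sym flip)
  ... | false | true  | flip = Bool.not-¬ refl flip

  others : List V
  others = filter (λ c → ¬? (c Fin.≟ component b₀)) (image component)

  ∈-others⁻ : ∀ {c} → c ∈ others → (∃[ u ] component u ≡ c) × c ≢ component b₀
  ∈-others⁻ c∈ =
    let c∈image , c≢b₀ = ∈.∈-filter⁻ (λ c → ¬? (c Fin.≟ component b₀)) {xs = image component} c∈
    in ∈-image⁻ component c∈image , c≢b₀

  suc-length-others : suc (length others) ≡ classes component
  suc-length-others = length-remove Fin._≟_ (image component) (image-unique component) (∈-image⁺ component b₀)

  none : V → Bool
  none _ = false

  only : V → V → Bool
  only c d = does (d Fin.≟ c)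

  either : V → V → V → Bool
  either c₁ c₂ d = only c₁ d ∨ only c₂ d

  -- Applied to the c − 1 other components this gives β(c − 1) selectors, more than c once c ≥ 3.
  selectors : List V → List (V → Bool)
  selectors []             = none ∷ []
  selectors (c ∷ [])       = none ∷ only c ∷ []
  selectors (c₁ ∷ c₂ ∷ cs) = either c₁ c₂ ∷ none ∷ map only (c₁ ∷ c₂ ∷ cs)

  length-selectors : ∀ cs → length (selectors cs) ≡ colourBound (length cs)
  length-selectors []             = refl
  length-selectors (c ∷ [])       = refl
  length-selectors (c₁ ∷ c₂ ∷ cs) = cong (4 +_) (List.length-map only cs)

  private
    separated-at : ∀ {S S′ c} → c ∈ others → S c ≡ true → S′ c ≡ false → Separates S S′
    separated-at {S} {S′} c∈ Sc S′c with proj₁ (∈-others⁻ c∈)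
    ... | u , refl = separated-by u λ Su≡S′u → Bool.not-¬ refl (trans (sym Sc) (trans Su≡S′u S′c))

    Separates-sym : ∀ {S S′} → Separates S S′ → Separates S′ S
    Separates-sym (separated-by u Su≢S′u) = separated-by u (Su≢S′u ∘ sym)

    only-self : ∀ c → only c c ≡ true
    only-self c = dec-true (c Fin.≟ c) refl

    only-other : ∀ {c d} → c ≢ d → only d c ≡ false
    only-other {c} {d} c≢d = dec-false (c Fin.≟ d) c≢d

    singletons-separated : ∀ cs → Unique cs → (∀ {c} → c ∈ cs → c ∈ others) →
                           AllPairs Separates (none ∷ map only cs)
    singletons-separated cs cs! cs⊆ =
      AllP.map⁺ (All.tabulate (λ {c} c∈ → Separates-sym (separated-at (cs⊆ c∈) (only-self c) refl)))
      ∷ AllPairs.map⁺ (onlys cs cs! cs⊆)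
      where
        onlys : ∀ cs → Unique cs → (∀ {c} → c ∈ cs → c ∈ others) →
                AllPairs (λ c d → Separates (only c) (only d)) cs
        onlys []       []          _   = []
        onlys (c ∷ cs) (c∉ ∷ cs!) cs⊆ =
          All.map (λ c≢d → separated-at (cs⊆ (here refl)) (only-self c) (only-other c≢d)) c∉
          ∷ onlys cs cs! (cs⊆ ∘ there)

  selectors-separated : ∀ cs → Unique cs → (∀ {c} → c ∈ cs → c ∈ others) →
                        AllPairs Separates (selectors cs)
  selectors-separated []             cs! cs⊆ = singletons-separated [] cs! cs⊆
  selectors-separated (c ∷ [])       cs! cs⊆ = singletons-separated (c ∷ []) cs! cs⊆
  selectors-separated (c₁ ∷ c₂ ∷ cs) cs! cs⊆ =
    (separated-at c₁∈ either-c₁ refl ∷ AllP.map⁺ (All.tabulate (λ {c} _ → either-vs-only c)))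
    ∷ singletons-separated (c₁ ∷ c₂ ∷ cs) cs! cs⊆
    where
      c₁∈ : c₁ ∈ others
      c₁∈ = cs⊆ (here refl)
      c₂∈ : c₂ ∈ others
      c₂∈ = cs⊆ (there (here refl))
      c₁≢c₂ : c₁ ≢ c₂
      c₁≢c₂ = All.lookup (AllPairs.head cs!) (here refl)
      either-c₁ : either c₁ c₂ c₁ ≡ true
      either-c₁ rewrite only-self c₁ = refl
      either-c₂ : either c₁ c₂ c₂ ≡ true
      either-c₂ rewrite only-self c₂ = Bool.∨-zeroʳ _
      either-vs-only : ∀ c → Separates (either c₁ c₂) (only c)
      either-vs-only c with c Fin.≟ c₁
      ... | yes refl = separated-at c₂∈ either-c₂ (only-other (c₁≢c₂ ∘ sym))
      ... | no  c≢c₁ = separated-at c₁∈ either-c₁ (only-other (c≢c₁ ∘ sym))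

  private
    only-off-b₀ : ∀ {c} → c ∈ others → only c (component b₀) ≡ false
    only-off-b₀ c∈ = only-other (proj₂ (∈-others⁻ c∈) ∘ sym)

  selectors-fix-b₀ : ∀ cs → (∀ {c} → c ∈ cs → c ∈ others) →
                     All (λ S → S (component b₀) ≡ false) (selectors cs)
  selectors-fix-b₀ []             cs⊆ = refl ∷ []
  selectors-fix-b₀ (c ∷ [])       cs⊆ = refl ∷ only-off-b₀ (cs⊆ (here refl)) ∷ []
  selectors-fix-b₀ (c₁ ∷ c₂ ∷ cs) cs⊆ = either-off ∷ refl ∷ AllP.map⁺ (All.tabulate (only-off-b₀ ∘ cs⊆))
    where
      either-off : either c₁ c₂ (component b₀) ≡ false
      either-off rewrite only-off-b₀ (cs⊆ (here refl)) | only-off-b₀ (cs⊆ (there (here refl))) = refl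

  recolourings : List (V → Bool)
  recolourings = map flipOn (selectors others)

  length-recolourings : length recolourings ≡ colourBound (length others)
  length-recolourings = trans (List.length-map flipOn (selectors others)) (length-selectors others)

  recolourings-unique : Unique≗ recolourings
  recolourings-unique = AllPairs.map⁺ (AllPairs.map flipOn-injective
    (selectors-separated others (Unique.filter⁺ _ (image-unique component)) id))

  ∈≗-recolourings⁻ : ∀ {κ} → κ ∈≗ recolourings → κ b₀ ≡ true × ProperColouring G κ
  ∈≗-recolourings⁻ κ∈ with find κ∈
  ... | κ′ , κ′∈ , κ≗κ′ with ∈.∈-map⁻ flipOn κ′∈
  ...   | S , S∈ , refl =
    trans (κ≗κ′ b₀)
      (trans (cong (if_then not (κ₀ b₀) else κ₀ b₀) (All.lookup (selectors-fix-b₀ others id) S∈)) κ₀b₀) ,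
    λ u v uv κu≡κv → flipOn-proper S u v uv (trans (sym (κ≗κ′ u)) (trans κu≡κv (κ≗κ′ v)))

  length-homs₂-≥ : length (arcs G) * length recolourings ≤ length (homs₂ G)
  length-homs₂-≥ = begin
    length (arcs G) * length recolourings            ≡⟨ sym (length-cartesianProduct (arcs G) recolourings) ⟩
    length (cartesianProduct (arcs G) recolourings)  ≤⟨ injection⇒length-≤ pairs (≗-decSetoid (n G) V Fin._≟_)
                                                          arcColourMap domain-unique injective into ⟩
    length (homs₂ G)                                 ∎
    where
      open ≤-Reasoning
      colourings = DecSetoid.setoid (≗-decSetoid (n G) Bool Bool._≟_)
      pairs = ≡.setoid (V × V) ×ₛ colourings
      open Membershipₛ pairs using () renaming (_∈_ to _∈ₚ_)
      domain = cartesianProduct (arcs G) recolourings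
      domain-unique : Uniqueₛ.Unique pairs domain
      domain-unique = UniqueₛProperties.cartesianProduct⁺ (≡.setoid (V × V)) colourings
                        (arcs-unique G) recolourings-unique
      ∈-domain⁻ : ∀ {p} → p ∈ₚ domain → proj₁ p ∈ arcs G × proj₂ p ∈≗ recolourings
      ∈-domain⁻ = MembershipₛProperties.∈-cartesianProduct⁻ (≡.setoid (V × V)) colourings (arcs G) recolourings
      arcColourMap : (V × V) × (V → Bool) → V → V
      arcColourMap ((x , y) , κ) = colourMap x y κ
      w₀-false : ∀ {κ} → κ ∈≗ recolourings → κ w₀ ≡ false
      w₀-false κ∈ with ∈≗-recolourings⁻ κ∈
      ... | κb₀ , proper = Bool.¬-not (λ κw₀≡true → proper b₀ w₀ b₀w₀ (trans κb₀ (sym κw₀≡true)))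
      injective : ∀ {p q} → p ∈ₚ domain → q ∈ₚ domain → arcColourMap p ≗ arcColourMap q → Setoid._≈_ pairs p q
      injective {(x , y) , _} p∈ q∈ same with ∈-domain⁻ p∈ | ∈-domain⁻ q∈
      ... | xy∈ , κ∈ | _ , κ′∈ = colourMap-injective (Adj⇒≢ G (∈-arcs⁻ G xy∈))
              (proj₁ (∈≗-recolourings⁻ κ∈)) (proj₁ (∈≗-recolourings⁻ κ′∈)) (w₀-false κ∈) same
      into : ∀ {p} → p ∈ₚ domain → arcColourMap p ∈≗ homs₂ G
      into {(x , y) , κ} p∈ with ∈-domain⁻ p∈
      ... | xy∈ , κ∈ = let xy = ∈-arcs⁻ G xy∈ ; proper = proj₂ (∈≗-recolourings⁻ κ∈) in
        homs₂-complete G (colourMap-hom G κ xy proper) (length-image-colourMap G κ (Adj⇒≢ G xy) (proper b₀ w₀ b₀w₀))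

single-vertex-tree : ∀ X → n X ≡ 1 → IsTree X
single-vertex-tree X one =
  (subst (0 <_) (sym one) (s≤s z≤n) , λ u v → subst (Star (Adj X) u) (all-equal u v) ε) ,
  λ { (_ , c , injective , _) → case injective (all-equal (c zero) (c (suc zero))) of λ () }
  where
    all-equal : ∀ (u v : Fin (n X)) → u ≡ v
    all-equal u v = Fin.toℕ-injective (trans (at-zero u) (sym (at-zero v)))
      where
        at-zero : ∀ (w : Fin (n X)) → toℕ w ≡ 0
        at-zero w = n<1⇒n≡0 (subst (toℕ w <_) one (Fin.toℕ<n w))

module _ (X : Graph) where
  open Components X

  one-class⇒connected : 0 < n X → classes component ≡ 1 → Connected X
  one-class⇒connected 0<n one = 0<n , λ u v → walk-component u v (same-class u v)
    where
      same-class : ∀ u v → component u ≡ component v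
      same-class u v with component u Fin.≟ component v
      ... | yes same      = same
      ... | no  different = case subst (2 ≤_) one (2≤length-image component different) of λ { (s≤s ()) }

  Closing : Fin (n X) → Fin (n X) → Fin (n X) × Fin (n X) → Set
  Closing x y e = e ≡ (x , y) ⊎ e ≡ (y , x)

  closing? : ∀ x y → Decidable (Closing x y)
  closing? x y e = ≡-dec Fin._≟_ Fin._≟_ e (x , y) ⊎-dec ≡-dec Fin._≟_ Fin._≟_ e (y , x)

  edges-without : Fin (n X) → Fin (n X) → List (Fin (n X) × Fin (n X))
  edges-without x y = filter (¬? ∘ closing? x y) (edges X)

  around-cycle : ∀ k (c : Fin (3 + k) → Fin (n X)) → (∀ {i j} → c i ≡ c j → i ≡ j) →
    (∀ i → Adj X (c (inject₁ i)) (c (suc i))) →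
    Star (Linked (edges-without (c (fromℕ (2 + k))) (c zero))) (c zero) (c (fromℕ (2 + k)))
  around-cycle k c injective steps = chain (2 + k) c step-kept
    where
      x = c (fromℕ (2 + k))
      y = c zero
      not-last : ∀ i → c (inject₁ i) ≢ x
      not-last i same = Fin.fromℕ≢inject₁ (sym (injective same))
      not-first-to-last : ∀ i → c (inject₁ i) ≡ y → c (suc i) ≢ x
      not-first-to-last i first last with injective first | Fin.suc-injective (injective last)
      not-first-to-last zero _ _ | _ | ()
      step-kept : ∀ i → Linked (edges-without x y) (c (inject₁ i)) (c (suc i))
      step-kept i with Adj⇒∈-edges X (steps i)
      ... | inj₁ e∈ = inj₁ (∈.∈-filter⁺ (¬? ∘ closing? x y) e∈
            λ { (inj₁ e≡xy) → not-last i (cong proj₁ e≡xy)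
              ; (inj₂ e≡yx) → not-first-to-last i (cong proj₁ e≡yx) (cong proj₂ e≡yx) })
      ... | inj₂ e∈ = inj₂ (∈.∈-filter⁺ (¬? ∘ closing? x y) e∈
            λ { (inj₁ e≡xy) → not-first-to-last i (cong proj₂ e≡xy) (cong proj₁ e≡xy)
              ; (inj₂ e≡yx) → not-last i (cong proj₂ e≡yx) })

  -- Dropping the closing edge of a cycle leaves a spanning set of pairs, which is too small.
  connected⇒acyclic : Connected X → n X ≡ suc (length (edges X)) → ¬ HasCycle X
  connected⇒acyclic connected order (k , c , injective , steps , closing) =
    <-irrefl refl (begin-strict
      n X                     ≤⟨ order-≤-spanning connected rest spans ⟩
      suc (length rest)       <⟨ s≤s (List.filter-notAll _ (edges X) closing∈) ⟩
      suc (length (edges X))  ≡⟨ sym order ⟩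
      n X                     ∎)
    where
      open ≤-Reasoning
      x = c (fromℕ (2 + k))
      y = c zero
      rest = edges-without x y
      closing∈ : Any (λ e → ¬ ¬ Closing x y e) (edges X)
      closing∈ with Adj⇒∈-edges X closing
      ... | inj₁ xy∈ = Any.map (λ { refl ¬closing → ¬closing (inj₁ refl) }) xy∈
      ... | inj₂ yx∈ = Any.map (λ { refl ¬closing → ¬closing (inj₂ refl) }) yx∈
      edge-spanned : ∀ {a b} → (a , b) ∈ edges X → Star (Linked rest) a b
      edge-spanned {a} {b} ab∈ with closing? x y (a , b)
      ... | yes (inj₁ refl) = reverse Linked-sym (around-cycle k c injective steps)
      ... | yes (inj₂ refl) = around-cycle k c injective steps
      ... | no  ¬closing    = inj₁ (∈.∈-filter⁺ (¬? ∘ closing? x y) ab∈ ¬closing) ◅ ε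
      spans : ∀ {a b} → Adj X a b → Star (Linked rest) a b
      spans ab with Adj⇒∈-edges X ab
      ... | inj₁ ab∈ = edge-spanned ab∈
      ... | inj₂ ba∈ = reverse Linked-sym (edge-spanned ba∈)

  tree-criterion : Connected X → n X ≡ suc (length (edges X)) → IsTree X
  tree-criterion connected order = connected , connected⇒acyclic connected order

module ThreeVertices (a : Fin 3 → Fin 3 → Bool) (a-sym : ∀ u v → a u v ≡ a v u) (a-irr : ∀ u → a u u ≡ false)
  where

  X : Graph
  X = record { n = 3 ; adj = a ; symm = a-sym ; irrefl = a-irr }

  table : Bool → Bool → Bool → Fin 3 → Fin 3 → Bool
  table b₀₁ b₀₂ b₁₂ zero             (suc zero)       = b₀₁
  table b₀₁ b₀₂ b₁₂ (suc zero)       zero             = b₀₁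
  table b₀₁ b₀₂ b₁₂ zero             (suc (suc zero)) = b₀₂
  table b₀₁ b₀₂ b₁₂ (suc (suc zero)) zero             = b₀₂
  table b₀₁ b₀₂ b₁₂ (suc zero)       (suc (suc zero)) = b₁₂
  table b₀₁ b₀₂ b₁₂ (suc (suc zero)) (suc zero)       = b₁₂
  table b₀₁ b₀₂ b₁₂ _                _                = false

  b₀₁ b₀₂ b₁₂ : Bool
  b₀₁ = a zero (suc zero)
  b₀₂ = a zero (suc (suc zero))
  b₁₂ = a (suc zero) (suc (suc zero))

  a≡table : ∀ u v → a u v ≡ table b₀₁ b₀₂ b₁₂ u v
  a≡table zero             zero             = a-irr zero
  a≡table zero             (suc zero)       = refl
  a≡table zero             (suc (suc zero)) = refl
  a≡table (suc zero)       zero             = a-sym _ _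
  a≡table (suc zero)       (suc zero)       = a-irr (suc zero)
  a≡table (suc zero)       (suc (suc zero)) = refl
  a≡table (suc (suc zero)) zero             = a-sym _ _
  a≡table (suc (suc zero)) (suc zero)       = a-sym _ _
  a≡table (suc (suc zero)) (suc (suc zero)) = a-irr (suc (suc zero))

  tableEdge? : ∀ c₀₁ c₀₂ c₁₂ (e : Fin 3 × Fin 3) →
               Dec (toℕ (proj₁ e) < toℕ (proj₂ e) × table c₀₁ c₀₂ c₁₂ (proj₁ e) (proj₂ e) ≡ true)
  tableEdge? c₀₁ c₀₂ c₁₂ (u , v) = (toℕ u <? toℕ v) ×-dec (table c₀₁ c₀₂ c₁₂ u v Bool.≟ true)

  tableEdges : Bool → Bool → Bool → List (Fin 3 × Fin 3)
  tableEdges c₀₁ c₀₂ c₁₂ = filter (tableEdge? c₀₁ c₀₂ c₁₂) (cartesianProduct (allFin 3) (allFin 3))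

  edges≡tableEdges : edges X ≡ tableEdges b₀₁ b₀₂ b₁₂
  edges≡tableEdges = List.filter-≐ (isEdge? X) (tableEdge? b₀₁ b₀₂ b₁₂)
    ((λ { (u<v , uv) → u<v , trans (sym (a≡table _ _)) uv }) , (λ { (u<v , uv) → u<v , trans (a≡table _ _) uv }))
    (cartesianProduct (allFin 3) (allFin 3))

  pointwise? : (f g : Fin 3 → Fin 3 → Bool) → Dec (∀ u v → f u v ≡ g u v)
  pointwise? f g = Fin.all? λ u → Fin.all? λ v → f u v Bool.≟ g u v

  -- For concrete values of the table the side condition evaluates, so it is proved by tt.
  isomorphic : ∀ (i j : Fin 3) (b : Fin 3 → Fin 3 → Bool) {c₀₁ c₀₂ c₁₂} → b₀₁ ≡ c₀₁ → b₀₂ ≡ c₀₂ → b₁₂ ≡ c₁₂ →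
    let π = Permutation.transpose i j in
    True (pointwise? (λ u v → b (π ⟨$⟩ʳ u) (π ⟨$⟩ʳ v)) (table c₀₁ c₀₂ c₁₂)) →
    Σ (Fin 3 ⤖ Fin 3) λ φ → ∀ u v → b (Bijection.to φ u) (Bijection.to φ v) ≡ a u v
  isomorphic i j b refl refl refl agrees =
    ↔⇒⤖ (Permutation.transpose i j) , λ u v → trans (toWitness agrees u v) (sym (a≡table u v))

  ≅P₃ : length (edges X) ≡ 2 → X ≅ P₃
  ≅P₃ two = cases b₀₁ b₀₂ b₁₂ refl refl refl (trans (cong length (sym edges≡tableEdges)) two)
    where
      cases : ∀ c₀₁ c₀₂ c₁₂ → b₀₁ ≡ c₀₁ → b₀₂ ≡ c₀₂ → b₁₂ ≡ c₁₂ → length (tableEdges c₀₁ c₀₂ c₁₂) ≡ 2 → X ≅ P₃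
      cases true  false true  e₀₁ e₀₂ e₁₂ _ = isomorphic zero zero p3adj e₀₁ e₀₂ e₁₂ tt
      cases true  true  false e₀₁ e₀₂ e₁₂ _ = isomorphic zero (suc zero) p3adj e₀₁ e₀₂ e₁₂ tt
      cases false true  true  e₀₁ e₀₂ e₁₂ _ = isomorphic (suc zero) (suc (suc zero)) p3adj e₀₁ e₀₂ e₁₂ tt
      cases true  true  true  _ _ _ ()
      cases true  false false _ _ _ ()
      cases false true  false _ _ _ ()
      cases false false true  _ _ _ ()
      cases false false false _ _ _ ()

  ≅K₁⊔K₂ : length (edges X) ≡ 1 → X ≅ K₁⊔K₂
  ≅K₁⊔K₂ one = cases b₀₁ b₀₂ b₁₂ refl refl refl (trans (cong length (sym edges≡tableEdges)) one)
    where
      cases : ∀ c₀₁ c₀₂ c₁₂ → b₀₁ ≡ c₀₁ → b₀₂ ≡ c₀₂ → b₁₂ ≡ c₁₂ → length (tableEdges c₀₁ c₀₂ c₁₂) ≡ 1 → X ≅ K₁⊔K₂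
      cases false false true  e₀₁ e₀₂ e₁₂ _ = isomorphic zero zero k12adj e₀₁ e₀₂ e₁₂ tt
      cases true  false false e₀₁ e₀₂ e₁₂ _ = isomorphic zero (suc (suc zero)) k12adj e₀₁ e₀₂ e₁₂ tt
      cases false true  false e₀₁ e₀₂ e₁₂ _ = isomorphic zero (suc zero) k12adj e₀₁ e₀₂ e₁₂ tt
      cases true  true  _     _ _ _ ()
      cases true  false true  _ _ _ ()
      cases false true  true  _ _ _ ()
      cases false false false _ _ _ ()

≅P₃ : ∀ X → n X ≡ 3 → length (edges X) ≡ 2 → X ≅ P₃
≅P₃ record { adj = a ; symm = a-sym ; irrefl = a-irr } refl = ThreeVertices.≅P₃ a a-sym a-irr

≅K₁⊔K₂ : ∀ X → n X ≡ 3 → length (edges X) ≡ 1 → X ≅ K₁⊔K₂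
≅K₁⊔K₂ record { adj = a ; symm = a-sym ; irrefl = a-irr } refl = ThreeVertices.≅K₁⊔K₂ a a-sym a-irr

trivial-or-edge : ∀ X → Connected X → n X ≡ 1 ⊎ ∃[ b ] ∃[ w ] Adj X b w
trivial-or-edge X (0<n , walks) with n X ℕ.≟ 1
... | yes one = inj₁ one
... | no  n≢1 = inj₂ (first-step (walks b₀ b₁) b₀≢b₁)
  where
    1<n : 1 < n X
    1<n = ≤∧≢⇒< 0<n (n≢1 ∘ sym)
    b₀ = fromℕ< 0<n
    b₁ = fromℕ< 1<n
    b₀≢b₁ : b₀ ≢ b₁
    b₀≢b₁ b₀≡b₁ = case trans (sym (Fin.toℕ-fromℕ< 0<n)) (trans (cong toℕ b₀≡b₁) (Fin.toℕ-fromℕ< 1<n)) of λ ()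
    first-step : ∀ {a c} → Star (Adj X) a c → a ≢ c → ∃[ b ] ∃[ w ] Adj X b w
    first-step ε        a≢a = ⊥-elim (a≢a refl)
    first-step (ab ◅ _) _   = _ , _ , ab

edge-counts : ∀ L eT eG → eG * colourBound L ≤ eT → suc eT ≤ suc L + eG → 1 ≤ eG →
              (L ≡ 0 × eG ≡ eT) ⊎ (L ≡ 1 × eG ≡ 1 × eT ≡ 2)
edge-counts zero eT eG bound order _ =
  inj₁ (refl , ≤-antisym (subst (_≤ eT) (*-identityʳ eG) bound) (s≤s⁻¹ order))
edge-counts 1 eT 1 bound order _ = inj₂ (refl , refl , ≤-antisym (s≤s⁻¹ order) bound)
edge-counts 1 eT (suc (suc e)) bound order _ = ⊥-elim (n≮n (3 + e) (begin-strict
  3 + e          <⟨ s≤s (+-monoʳ-≤ 3 (m≤m*n e 2)) ⟩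
  4 + e * 2      ≤⟨ bound ⟩
  eT             ≤⟨ s≤s⁻¹ order ⟩
  3 + e          ∎))
  where open ≤-Reasoning
edge-counts (suc (suc r)) eT (suc e) bound order _ = ⊥-elim (n≮n (3 + r + e) (begin-strict
  3 + r + e                 <⟨ s≤s (+-monoʳ-≤ (3 + r) (m≤m*n e (4 + r))) ⟩
  (4 + r) + e * (4 + r)     ≤⟨ bound ⟩
  eT                        ≤⟨ s≤s⁻¹ order ⟩
  suc (suc r) + suc e       ≡⟨ +-suc (2 + r) e ⟩
  3 + r + e                 ∎))
  where open ≤-Reasoning

module Comparison (T G : Graph) (tree : IsTree T) (same : SameSelfX T G)
                  {b w : Fin (n T)} (bw : Adj T b w) where
  open SameSelfChromatic T G same public
  open Tree T tree public

  G-edge : ∃[ u ] ∃[ v ] Adj G u v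
  G-edge with Fin.any? (λ u → Fin.any? (λ v → adj G u v Bool.≟ true))
  ... | yes (u , v , uv) = u , v , uv
  ... | no  edgeless     = case trans (sym (same-type-counts ks)) no-T-homs of λ d≡0 →
                              case subst (1 ≤_) d≡0 (d-pos⁺ G const-hom) of λ ()
    where
      g₀ = subst Fin same-order b
      const : Fin (n G) → Fin (n G)
      const _ = g₀
      const-hom : IsHom G G const
      const-hom u v uv = ⊥-elim (edgeless (u , v , uv))
      ks = typeOf const
      no-T-homs : d T T ks ≡ 0
      no-T-homs = cong length (List.filter-none (λ f → List.≡-dec ℕ._≟_ (typeOf f) ks)
        (All.tabulate λ {f} f∈ type≡ → case begin
          2                     ≤⟨ 2≤length-image f (Adj⇒≢ T (∈-homs⁻ T T f∈ b w bw)) ⟩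
          length (image f)      ≡⟨ sym (length-typeOf f) ⟩
          length (typeOf f)     ≡⟨ cong length type≡ ⟩
          length ks             ≡⟨ length-typeOf const ⟩
          length (image const)  ≡⟨ length-image-const const {g₀} (λ _ → refl) ⟩
          1                     ∎ of λ { (s≤s ()) }))
        where open ≤-Reasoning

  private
    g : Fin (n G)
    g = proj₁ G-edge
    gh : Adj G g (proj₁ (proj₂ G-edge))
    gh = proj₂ (proj₂ G-edge)
    κ : Fin (n T) → Bool
    κ = proj₁ proper-colouring
    κ-proper : ProperColouring T κ
    κ-proper = proj₂ proper-colouring

    1≤homs₂-G : 1 ≤ length (homs₂ G)
    1≤homs₂-G = subst (1 ≤_) same-homs₂-count (MembershipₛProperties.∈-length (maps (n T) (n T))
      (homs₂-complete T (colourMap-hom T κ bw κ-proper)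
                        (length-image-colourMap T κ (Adj⇒≢ T bw) (κ-proper b w bw))))

    G-colouring : Σ (Fin (n G) → Bool) λ κ₀ → κ₀ g ≡ true × ProperColouring G κ₀
    G-colouring with nonempty-filter (λ f → length (image f) ℕ.≟ 2) (homs G G) 1≤homs₂-G
    ... | f , f∈ , two = colouring-from-homs₂ G (∈-homs⁻ G G f∈) two g

    module G = Components G
    module R = Recolourings G gh (proj₁ G-colouring) (proj₁ (proj₂ G-colouring)) (proj₂ (proj₂ G-colouring))

  open R public using (others; suc-length-others)

  has-edge : 1 ≤ length (edges G)
  has-edge = [ MembershipₛProperties.∈-length (≡.setoid _) , MembershipₛProperties.∈-length (≡.setoid _) ]′
               (Adj⇒∈-edges G gh)

  order-bound : suc (length (edges T)) ≤ suc (length others) + length (edges G)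
  order-bound = begin
    suc (length (edges T))                              ≡⟨ sym order≡suc-size ⟩
    n T                                                 ≡⟨ same-order ⟩
    n G                                                 ≡⟨ sym (G.components+merges (edges G)) ⟩
    G.classes G.component + G.merges id (edges G)       ≡⟨ cong (_+ G.merges id (edges G)) (sym suc-length-others) ⟩
    suc (length others) + G.merges id (edges G)         ≤⟨ +-monoʳ-≤ (suc (length others)) (G.merges-≤ id (edges G)) ⟩
    suc (length others) + length (edges G)              ∎
    where open ≤-Reasoning

  colour-bound : length (edges G) * colourBound (length others) ≤ length (edges T)
  colour-bound = *-cancelʳ-≤ _ _ 2 (begin
    eG * c * 2                                ≡⟨ *-assoc eG c 2 ⟩
    eG * (c * 2)                              ≡⟨ cong (eG *_) (*-comm c 2) ⟩
    eG * (2 * c)                              ≡⟨ sym (*-assoc eG 2 c) ⟩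
    eG * 2 * c                                ≡⟨ sym (cong₂ _*_ (length-arcs G) R.length-recolourings) ⟩
    length (arcs G) * length R.recolourings   ≤⟨ R.length-homs₂-≥ ⟩
    length (homs₂ G)                          ≡⟨ sym same-homs₂-count ⟩
    length (homs₂ T)                          ≤⟨ length-homs₂-≤ T (proj₁ tree) bw ⟩
    length (arcs T)                           ≡⟨ length-arcs T ⟩
    length (edges T) * 2                      ∎)
    where
      open ≤-Reasoning
      eG = length (edges G)
      c = colourBound (length others)

proposition2p7 : (T G : Graph) → IsTree T → SameSelfX T G →
    IsTree G ⊎ ((T ≅ P₃) × (G ≅ K₁⊔K₂))
proposition2p7 T G tree same with trivial-or-edge T (proj₁ tree)
... | inj₁ one = inj₁ (single-vertex-tree G (trans (sym same-order) one))
  where open SameSelfChromatic T G same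
... | inj₂ (_ , _ , bw) = conclude (edge-counts _ _ _ colour-bound order-bound has-edge)
  where
    open Comparison T G tree same bw
    conclude : (length others ≡ 0 × length (edges G) ≡ length (edges T)) ⊎
               (length others ≡ 1 × length (edges G) ≡ 1 × length (edges T) ≡ 2) →
               IsTree G ⊎ ((T ≅ P₃) × (G ≅ K₁⊔K₂))
    conclude (inj₁ (no-others , eG≡eT)) = inj₁ (tree-criterion G
      (one-class⇒connected G (subst (0 <_) same-order (proj₁ (proj₁ tree)))
                             (trans (sym suc-length-others) (cong suc no-others)))
      (trans (sym same-order) (trans order≡suc-size (cong suc (sym eG≡eT)))))
    conclude (inj₂ (_ , eG≡1 , eT≡2)) =
      inj₂ (≅P₃ T three eT≡2 , ≅K₁⊔K₂ G (trans (sym same-order) three) eG≡1)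
      where three = trans order≡suc-size (cong suc eT≡2)
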